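{- Let $\mathbb{F}$ be a field of characteristic $0$ and let $n,d$ be positive integers with $d\ge n+1$. Then $\mathcal{P}(d)\otimes\overline{\mathcal{P}}(d)$ is spanned by $\mathfrak{M}(d)\cup\ker(\phi)$.
   Context: $\mathcal{P}(d)$ is the $\mathbb{F}$-vector space spanned by symbols $[S]$ for $d\times n$ arrays $S$ containing each of $1,\dots,dn$ exactly once, subject to: exchanging two entries in the same row multiplies the symbol by $-1$; $\overline{\mathcal{P}}(d)$ is an identical copy with entries $\bar 1,\dots,\overline{dn}$. With $V=W=\mathbb{F}^n$, the linear map $\phi$ sends $[S]\otimes[\bar T]$ to the multilinear function on $(V\otimes W)^{\oplus dn}$ extending $(v_1\otimes w_1)\oplus\cdots\oplus(v_{dn}\otimes w_{dn})\mapsto\prod_{i=1}^d\det[v_{S(i,1)},\dots,v_{S(i,n)}]\prod_{j=1}^d\det[w_{T(j,1)},\dots,w_{T(j,n)}]$. A correlated tableau is a $d\times d$ matrix $C$ of subsets of $[dn]$ partitioning $[dn]$ with every row union and every column union of size $n$; its associated element of $\mathcal{P}(d)\otimes\overline{\mathcal{P}}(d)$ is $[S]\otimes[\bar T]$ where row $i$ of $S$ lists the elements of $C(i,1),\dots,C(i,d)$ in order and row $j$ of $T$ lists those of $C(1,j),\dots,C(d,j)$ in order (increasing within each entry). Its graph is the bipartite multigraph on left vertices $[d]$ and right vertices $[d]$ with $|C(i,j)|$ edges between left $i$ and right $j$. $\mathfrak{M}(d)$ is the span of the elements associated to those correlated tableaux whose graph is either disconnected or has at least one multiple edge (some $|C(i,j)|\ge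 2$). -}

module Defs where

open import Level using (Level; _⊔_)
open import Algebra.Bundles using (CommutativeRing)
open import Data.Nat as ℕ using (ℕ; zero; suc; _≤_)
open import Data.Fin as Fin using (Fin; zero; suc; punchIn)
open import Data.Fin.Subset using (Subset; _∈_; ⋃; ∣_∣)
open import Data.Fin.Subset.Properties using (_∈?_)
open import Data.List as List using (List; []; _∷_; allFin; filter; concatMap)
open import Data.Vec.Functional as VF using (toList)
open import Data.Product using (Σ; ∃; ∃-syntax; _×_; _,_)
open import Data.Sum using (_⊎_; inj₁; inj₂)
open import Relation.Binary.PropositionalEquality using (_≡_)
open import Relation.Nullary using (¬_)
open import Relation.Binary.Construct.Closure.ReflexiveTransitive using (Star)

IsFilling : (d n : ℕ) → (Fin d → Fin n → Fin (d ℕ.* n)) → Set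
IsFilling d n S =
  (∀ k → ∃[ i ] ∃[ c ] S i c ≡ k) ×
  (∀ i c i′ c′ → S i c ≡ S i′ c′ → i ≡ i′ × c ≡ c′)

Tableau : (d n : ℕ) → Set
Tableau d n = Fin d → Fin d → Subset (d ℕ.* n)

IsCorrelated : (d n : ℕ) → Tableau d n → Set
IsCorrelated d n C =
  (∀ k → ∃[ i ] ∃[ j ] k ∈ C i j) ×
  (∀ k i j i′ j′ → k ∈ C i j → k ∈ C i′ j′ → i ≡ i′ × j ≡ j′) ×
  (∀ i → ∣ ⋃ (List.map (λ j → C i j) (allFin d)) ∣ ≡ n) ×
  (∀ j → ∣ ⋃ (List.map (λ i → C i j) (allFin d)) ∣ ≡ n)

elems : ∀ {m} → Subset m → List (Fin m)
elems {m} p = filter (λ k → k ∈? p) (allFin m)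

rowList : ∀ {d n} → Tableau d n → Fin d → List (Fin (d ℕ.* n))
rowList {d} C i = concatMap (λ j → elems (C i j)) (allFin d)

colList : ∀ {d n} → Tableau d n → Fin d → List (Fin (d ℕ.* n))
colList {d} C j = concatMap (λ i → elems (C i j)) (allFin d)

IsAssociated : ∀ {d n} → Tableau d n →
               (Fin d → Fin n → Fin (d ℕ.* n)) →
               (Fin d → Fin n → Fin (d ℕ.* n)) → Set
IsAssociated C S T =
  (∀ i → toList (S i) ≡ rowList C i) × (∀ j → toList (T j) ≡ colList C j)

-- The bipartite multigraph of C: left vertices inj₁ i, right vertices inj₂ j,
-- with |C(i,j)| edges between left i and right j.
Vertex : ℕ → Set
Vertex d = Fin d ⊎ Fin d

Adj : ∀ {d n} → Tableau d n → Vertex d → Vertex d → Set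
Adj C (inj₁ i) (inj₂ j) = 1 ≤ ∣ C i j ∣
Adj C (inj₂ j) (inj₁ i) = 1 ≤ ∣ C i j ∣
Adj C (inj₁ _) (inj₁ _) = Data.Empty.⊥
  where import Data.Empty
Adj C (inj₂ _) (inj₂ _) = Data.Empty.⊥
  where import Data.Empty

GraphConnected : ∀ {d n} → Tableau d n → Set
GraphConnected {d} C = ∀ (u v : Vertex d) → Star (Adj C) u v

HasMultipleEdge : ∀ {d n} → Tableau d n → Set
HasMultipleEdge C = ∃[ i ] ∃[ j ] 2 ≤ ∣ C i j ∣

-- the graph is disconnected or has a multiple edge (tableaux spanning 𝔐(d))
InM : ∀ {d n} → Tableau d n → Set
InM C = ¬ GraphConnected C ⊎ HasMultipleEdge C

module _ {c ℓ : Level} (R : CommutativeRing c ℓ) where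
  open CommutativeRing R using (Carrier; _≈_; _+_; _*_; -_; 0#; 1#)

  IsField : Set (c ⊔ ℓ)
  IsField = (¬ (1# ≈ 0#)) × (∀ x → ¬ (x ≈ 0#) → ∃[ y ] (x * y ≈ 1#))

  natR : ℕ → Carrier
  natR zero    = 0#
  natR (suc m) = 1# + natR m

  CharZero : Set ℓ
  CharZero = ∀ m → ¬ (natR (suc m) ≈ 0#)

  sumR : ∀ {m} → (Fin m → Carrier) → Carrier
  sumR {zero}  f = 0#
  sumR {suc m} f = f zero + sumR (λ i → f (suc i))

  prodR : ∀ {m} → (Fin m → Carrier) → Carrier
  prodR {zero}  f = 1#
  prodR {suc m} f = f zero * prodR (λ i → f (suc i))

  signR : ∀ {m} → Fin m → Carrier
  signR zero    = 1#
  signR (suc j) = - signR j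

  det : ∀ {m} → (Fin m → Fin m → Carrier) → Carrier
  det {zero}  M = 1#
  det {suc m} M =
    sumR (λ j → signR j * (M zero j * det (λ r s → M (suc r) (punchIn j s))))

  -- φ([S] ⊗ [T̄]) evaluated at (v₁ ⊗ w₁) ⊕ ⋯ ⊕ (v_{dn} ⊗ w_{dn}), with
  -- vᵏ, wᵏ ∈ Rⁿ (vectors as functions Fin n → R).  Since a multilinear
  -- function on (V ⊗ W)^{⊕dn} is determined by its values on such tuples,
  -- this determines φ([S] ⊗ [T̄]) completely.
  φ : ∀ {d n} → (S T : Fin d → Fin n → Fin (d ℕ.* n)) →
      (v w : Fin (d ℕ.* n) → Fin n → Carrier) → Carrier
  φ S T v w =
    prodR (λ i → det (λ r s → v (S i s) r)) *
    prodR (λ j → det (λ r s → w (T j s) r))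

  -- A term of a linear combination of elements of 𝔐(d): a coefficient times
  -- the element [S] ⊗ [T̄] associated to a correlated tableau whose graph is
  -- disconnected or has a multiple edge.
  record MTerm (d n : ℕ) : Set c where
    field
      coeff      : Carrier
      tableau    : Tableau d n
      correlated : IsCorrelated d n tableau
      inM        : InM tableau
      arrS       : Fin d → Fin n → Fin (d ℕ.* n)
      arrT       : Fin d → Fin n → Fin (d ℕ.* n)
      associated : IsAssociated tableau arrS arrT

  φComb : ∀ {d n} → List (MTerm d n) →
          (v w : Fin (d ℕ.* n) → Fin n → Carrier) → Carrier
  φComb []       v w = 0#
  φComb (t ∷ ts) v w =
    MTerm.coeff t * φ (MTerm.arrS t) (MTerm.arrT t) v w + φComb ts v w

-- Let C be the tableau of a pair of fillings (S, T): C(i, j) holds the labels lying in row i of S and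
-- in row j of T. Up to sign, [S] ⊗ [T̄] is the element associated to C, so it lies in 𝔐(d) unless the
-- graph of C is connected and has no multiple edge. In that case, take two labels in a common row of T
-- (or of S) but in different rows of S (resp. T); the Plücker exchange between those two rows shows that
-- swapping the labels multiplies φ([S] ⊗ [T̄]) by −1 modulo φ(𝔐(d)), the error terms having a multiple edge.
-- Conjugating along paths of the connected graph, every transposition of labels acts by −1, hence every
-- permutation π of the labels acts by sgn π. Summing over π, (dn)! · φ([S] ⊗ [T̄]) is congruent modulo
-- φ(𝔐(d)) to the antisymmetrisation of φ([S] ⊗ [T̄]) over the dn labels; this is an alternating multilinear
-- function of the dn vectors vₖ ⊗ wₖ of the n²-dimensional space V ⊗ W, so it vanishes since dn > n².
-- In characteristic 0, (dn)! and 2 are invertible.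

module Submission where

open import Level using (Level; _⊔_)
open import Algebra.Bundles using (CommutativeRing)
open import Data.Nat using (ℕ)
open import Relation.Nullary using (¬_)
open import Defs using (IsFilling; HasMultipleEdge)

module Transpositions where
  open import Data.Nat using (zero; suc)
  open import Data.Fin using (Fin; zero; suc; toℕ; inject₁; punchIn)
  open import Data.Fin.Properties using (_≟_)
  import Data.Fin.Permutation as Perm
  open import Data.Fin.Permutation.Components using (transpose)
  open import Data.Sum using (_⊎_; inj₁; inj₂)
  open import Function using (_∘_)
  open import Relation.Nullary using (yes; no)
  open import Relation.Nullary.Decidable using (dec-true; dec-false)
  open import Relation.Binary.PropositionalEquality as ≡ using (_≡_; _≢_)

  data TransposeView {m} (i j k : Fin m) : Set where
    at-i      : k ≡ i → TransposeView i j k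
    at-j      : k ≡ j → k ≢ i → TransposeView i j k
    elsewhere : k ≢ i → k ≢ j → TransposeView i j k

  transposeView : ∀ {m} (i j k : Fin m) → TransposeView i j k
  transposeView i j k with k ≟ i | k ≟ j
  ... | yes k≡i | _       = at-i k≡i
  ... | no k≢i  | yes k≡j = at-j k≡j k≢i
  ... | no k≢i  | no k≢j  = elsewhere k≢i k≢j

  transpose-i : ∀ {m} (i j : Fin m) → transpose i j i ≡ j
  transpose-i i j rewrite dec-true (i ≟ i) ≡.refl = ≡.refl

  transpose-j : ∀ {m} (i j : Fin m) → transpose i j j ≡ i
  transpose-j i j with j ≟ i
  ... | yes j≡i = j≡i
  ... | no _ rewrite dec-true (j ≟ j) ≡.refl = ≡.refl

  transpose-other : ∀ {m} (i j : Fin m) {k} → k ≢ i → k ≢ j → transpose i j k ≡ k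
  transpose-other i j {k} k≢i k≢j rewrite dec-false (k ≟ i) k≢i | dec-false (k ≟ j) k≢j = ≡.refl

  transpose-comm : ∀ {m} (i j k : Fin m) → transpose i j k ≡ transpose j i k
  transpose-comm i j k with transposeView i j k
  ... | at-i ≡.refl       = ≡.trans (transpose-i k j) (≡.sym (transpose-j j k))
  ... | at-j ≡.refl _     = ≡.trans (transpose-j i k) (≡.sym (transpose-i k i))
  ... | elsewhere k≢i k≢j = ≡.trans (transpose-other i j k≢i k≢j) (≡.sym (transpose-other j i k≢j k≢i))

  transpose-suc : ∀ {m} (i j k : Fin m) → transpose (suc i) (suc j) (suc k) ≡ suc (transpose i j k)
  transpose-suc i j k = Perm.lift₀-transpose i j (suc k)

  transpose-conj : ∀ {m} {i j k : Fin m} → i ≢ j → i ≢ k → j ≢ k →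
                   ∀ x → transpose i j x ≡ transpose i k (transpose k j (transpose i k x))
  transpose-conj {i = i} {j} {k} i≢j i≢k j≢k x with transposeView i j x
  ... | at-i ≡.refl = begin
    transpose i j i                                 ≡⟨ transpose-i i j ⟩
    j                                               ≡⟨ transpose-other i k (i≢j ∘ ≡.sym) j≢k ⟨
    transpose i k j                                 ≡⟨ ≡.cong (transpose i k) (transpose-i k j) ⟨
    transpose i k (transpose k j k)                 ≡⟨ ≡.cong (transpose i k ∘ transpose k j) (transpose-i i k) ⟨
    transpose i k (transpose k j (transpose i k i)) ∎
    where open ≡.≡-Reasoning
  ... | at-j ≡.refl j≢i = begin
    transpose i j j                                 ≡⟨ transpose-j i j ⟩
    i                                               ≡⟨ transpose-j i k ⟨
    transpose i k k                                 ≡⟨ ≡.cong (transpose i k) (transpose-j k j) ⟨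
    transpose i k (transpose k j j)                 ≡⟨ ≡.cong (transpose i k ∘ transpose k j) (transpose-other i k j≢i j≢k) ⟨
    transpose i k (transpose k j (transpose i k j)) ∎
    where open ≡.≡-Reasoning
  ... | elsewhere x≢i x≢j with x ≟ k
  ...   | yes ≡.refl = begin
    transpose i j k                                 ≡⟨ transpose-other i j x≢i x≢j ⟩
    k                                               ≡⟨ transpose-i i k ⟨
    transpose i k i                                 ≡⟨ ≡.cong (transpose i k) (transpose-other k j i≢k i≢j) ⟨
    transpose i k (transpose k j i)                 ≡⟨ ≡.cong (transpose i k ∘ transpose k j) (transpose-j i k) ⟨
    transpose i k (transpose k j (transpose i k k)) ∎
    where open ≡.≡-Reasoning
  ...   | no x≢k = begin
    transpose i j x                                 ≡⟨ transpose-other i j x≢i x≢j ⟩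
    x                                               ≡⟨ transpose-other i k x≢i x≢k ⟨
    transpose i k x                                 ≡⟨ ≡.cong (transpose i k) (transpose-other k j x≢k x≢j) ⟨
    transpose i k (transpose k j x)                 ≡⟨ ≡.cong (transpose i k ∘ transpose k j) (transpose-other i k x≢i x≢k) ⟨
    transpose i k (transpose k j (transpose i k x)) ∎
    where open ≡.≡-Reasoning

  transpose-natural : ∀ {m} (σ : Fin m → Fin m) → (∀ {x y} → σ x ≡ σ y → x ≡ y) →
                      ∀ i j k → transpose (σ i) (σ j) (σ k) ≡ σ (transpose i j k)
  transpose-natural σ σ-inj i j k with transposeView i j k
  ... | at-i ≡.refl       = ≡.trans (transpose-i (σ k) (σ j)) (≡.cong σ (≡.sym (transpose-i k j)))
  ... | at-j ≡.refl _     = ≡.trans (transpose-j (σ i) (σ k)) (≡.cong σ (≡.sym (transpose-j i k)))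
  ... | elsewhere k≢i k≢j = ≡.trans (transpose-other (σ i) (σ j) (k≢i ∘ σ-inj) (k≢j ∘ σ-inj))
                                    (≡.cong σ (≡.sym (transpose-other i j k≢i k≢j)))

  adjacentSwap : ∀ {m} → Fin m → Fin (suc m) → Fin (suc m)
  adjacentSwap {suc m} zero    zero          = suc zero
  adjacentSwap {suc m} zero    (suc zero)    = zero
  adjacentSwap {suc m} zero    (suc (suc x)) = suc (suc x)
  adjacentSwap {suc m} (suc t) zero          = zero
  adjacentSwap {suc m} (suc t) (suc x)       = suc (adjacentSwap t x)

  adjacentSwap-involutive : ∀ {m} (t : Fin m) x → adjacentSwap t (adjacentSwap t x) ≡ x
  adjacentSwap-involutive {suc m} zero    zero          = ≡.refl
  adjacentSwap-involutive {suc m} zero    (suc zero)    = ≡.refl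
  adjacentSwap-involutive {suc m} zero    (suc (suc x)) = ≡.refl
  adjacentSwap-involutive {suc m} (suc t) zero          = ≡.refl
  adjacentSwap-involutive {suc m} (suc t) (suc x)       = ≡.cong suc (adjacentSwap-involutive t x)

  adjacentSwap≡transpose : ∀ {m} (t : Fin m) x → adjacentSwap t x ≡ transpose (inject₁ t) (suc t) x
  adjacentSwap≡transpose {suc m} zero    zero          = ≡.sym (transpose-i zero (suc zero))
  adjacentSwap≡transpose {suc m} zero    (suc zero)    = ≡.sym (transpose-j zero (suc zero))
  adjacentSwap≡transpose {suc m} zero    (suc (suc x)) = ≡.refl
  adjacentSwap≡transpose {suc m} (suc t) zero          = ≡.refl
  adjacentSwap≡transpose {suc m} (suc t) (suc x)       =
    ≡.trans (≡.cong suc (adjacentSwap≡transpose t x)) (≡.sym (transpose-suc (inject₁ t) (suc t) x))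

  Neighbours : ∀ {m} → Fin m → Fin m → Set
  Neighbours a b = toℕ a ≡ suc (toℕ b) ⊎ toℕ b ≡ suc (toℕ a)

  -- How an adjacent column swap acts on the minors of a Laplace expansion (column j deleted).
  data SwapAtColumn {m} (t : Fin (suc m)) (j : Fin (suc (suc m))) : Set where
    moves : Neighbours (adjacentSwap t j) j →
            (∀ s → adjacentSwap t (punchIn (adjacentSwap t j) s) ≡ punchIn j s) → SwapAtColumn t j
    fixes : adjacentSwap t j ≡ j → (t′ : Fin m) →
            (∀ s → adjacentSwap t (punchIn j s) ≡ punchIn j (adjacentSwap t′ s)) → SwapAtColumn t j

  swapAtColumn : ∀ {m} (t : Fin (suc m)) (j : Fin (suc (suc m))) → SwapAtColumn t j
  swapAtColumn zero zero       = moves (inj₁ ≡.refl) λ { zero → ≡.refl ; (suc s) → ≡.refl }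
  swapAtColumn zero (suc zero) = moves (inj₂ ≡.refl) λ { zero → ≡.refl ; (suc s) → ≡.refl }
  swapAtColumn {suc m} zero (suc (suc j)) =
    fixes ≡.refl zero λ { zero → ≡.refl ; (suc zero) → ≡.refl ; (suc (suc s)) → ≡.refl }
  swapAtColumn {suc m} (suc t) zero = fixes ≡.refl t λ { zero → ≡.refl ; (suc s) → ≡.refl }
  swapAtColumn {suc m} (suc t) (suc j) with swapAtColumn t j
  ... | moves (inj₁ n) e = moves (inj₁ (≡.cong suc n)) λ { zero → ≡.refl ; (suc s) → ≡.cong suc (e s) }
  ... | moves (inj₂ n) e = moves (inj₂ (≡.cong suc n)) λ { zero → ≡.refl ; (suc s) → ≡.cong suc (e s) }
  ... | fixes e t′ e′    = fixes (≡.cong suc e) (suc t′) λ { zero → ≡.refl ; (suc s) → ≡.cong suc (e′ s) }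

module LehmerCodes where
  open import Data.Nat as ℕ using (ℕ; zero; suc)
  import Data.Nat.Properties as ℕ
  open import Data.Fin as Fin using (Fin; zero; suc; toℕ; punchIn; punchOut)
  open import Data.Fin.Properties using (punchIn-punchOut; punchOut-injective; suc-injective)
  open import Data.List using (List; []; _∷_; _++_; map; length)
  open import Data.List.Properties using (length-++; length-map)
  open import Data.Product using (_×_; _,_)
  open import Data.Unit using (⊤; tt)
  open import Relation.Binary.PropositionalEquality as ≡ using (_≡_; _≢_)
  open Transpositions using (adjacentSwap)

  LehmerCode : ℕ → Set
  LehmerCode zero    = ⊤
  LehmerCode (suc m) = Fin (suc m) × LehmerCode m

  decode : ∀ {m} → LehmerCode m → Fin m → Fin m
  decode (j , π) zero    = j
  decode (j , π) (suc r) = punchIn j (decode π r)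

  inversions : ∀ {m} → LehmerCode m → ℕ
  inversions {zero}  _       = 0
  inversions {suc m} (j , π) = toℕ j ℕ.+ inversions π

  identityCode : ∀ {m} → LehmerCode m
  identityCode {zero}  = tt
  identityCode {suc m} = zero , identityCode

  decode-identityCode : ∀ {m} (x : Fin m) → decode identityCode x ≡ x
  decode-identityCode zero    = ≡.refl
  decode-identityCode (suc x) = ≡.cong suc (decode-identityCode x)

  inversions-identityCode : ∀ {m} → inversions (identityCode {m}) ≡ 0
  inversions-identityCode {zero}  = ≡.refl
  inversions-identityCode {suc m} = inversions-identityCode {m}

  encode : ∀ {m} (ρ : Fin m → Fin m) → (∀ {x y} → ρ x ≡ ρ y → x ≡ y) → LehmerCode m
  encode {zero}  ρ ρ-inj = tt
  encode {suc m} ρ ρ-inj =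
    ρ zero , encode (λ r → punchOut (ρ0≢ r)) (λ {x} {y} e → suc-injective (ρ-inj (punchOut-injective (ρ0≢ x) (ρ0≢ y) e)))
    where
    ρ0≢ : ∀ r → ρ zero ≢ ρ (suc r)
    ρ0≢ r e with ρ-inj e
    ... | ()

  decode-encode : ∀ {m} (ρ : Fin m → Fin m) (ρ-inj : ∀ {x y} → ρ x ≡ ρ y → x ≡ y) x → decode (encode ρ ρ-inj) x ≡ ρ x
  decode-encode {suc m} ρ ρ-inj zero    = ≡.refl
  decode-encode {suc m} ρ ρ-inj (suc r) = ≡.trans (≡.cong (punchIn (ρ zero)) (decode-encode _ _ r)) (punchIn-punchOut _)

  -- t : Fin m stands for the transposition of t and t + 1 in Fin (suc m); apply (t₁ ∷ ⋯ ∷ tₖ) = t₁ ∘ ⋯ ∘ tₖ.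
  Word : ℕ → Set
  Word m = List (Fin m)

  apply : ∀ {m} → Word m → Fin (suc m) → Fin (suc m)
  apply []       x = x
  apply (t ∷ ts) x = adjacentSwap t (apply ts x)

  apply-++ : ∀ {m} (ts us : Word m) x → apply (ts ++ us) x ≡ apply ts (apply us x)
  apply-++ []       us x = ≡.refl
  apply-++ (t ∷ ts) us x = ≡.cong (adjacentSwap t) (apply-++ ts us x)

  apply-map-suc : ∀ {m} (ts : Word m) x → apply (map suc ts) x ≡ Fin.lift 1 (apply ts) x
  apply-map-suc []       zero    = ≡.refl
  apply-map-suc []       (suc x) = ≡.refl
  apply-map-suc (t ∷ ts) zero    = ≡.cong (adjacentSwap (suc t)) (apply-map-suc ts zero)
  apply-map-suc (t ∷ ts) (suc x) = ≡.cong (adjacentSwap (suc t)) (apply-map-suc ts (suc x))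

  cycleWord : ∀ {m} → Fin (suc m) → Word m
  cycleWord zero            = []
  cycleWord {suc m} (suc j) = map suc (cycleWord j) ++ (zero ∷ [])

  apply-cycleWord : ∀ {m} (j : Fin (suc m)) x → apply (cycleWord j) x ≡ decode (j , identityCode) x
  apply-cycleWord zero    zero    = ≡.refl
  apply-cycleWord zero    (suc x) = ≡.cong suc (≡.sym (decode-identityCode x))
  apply-cycleWord {suc m} (suc j) x = begin
    apply (map suc (cycleWord j) ++ (zero ∷ [])) x         ≡⟨ apply-++ (map suc (cycleWord j)) (zero ∷ []) x ⟩
    apply (map suc (cycleWord j)) (adjacentSwap zero x)    ≡⟨ apply-map-suc (cycleWord j) (adjacentSwap zero x) ⟩
    Fin.lift 1 (apply (cycleWord j)) (adjacentSwap zero x) ≡⟨ shifted x ⟩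
    decode (suc j , identityCode) x                        ∎
    where
    open ≡.≡-Reasoning
    shifted : ∀ x → Fin.lift 1 (apply (cycleWord j)) (adjacentSwap zero x) ≡ decode (suc j , identityCode) x
    shifted zero          = ≡.cong suc (apply-cycleWord j zero)
    shifted (suc zero)    = ≡.refl
    shifted (suc (suc y)) = ≡.cong suc (apply-cycleWord j (suc y))

  length-cycleWord : ∀ {m} (j : Fin (suc m)) → length (cycleWord j) ≡ toℕ j
  length-cycleWord zero            = ≡.refl
  length-cycleWord {suc m} (suc j) = begin
    length (map suc (cycleWord j) ++ (zero ∷ [])) ≡⟨ length-++ (map suc (cycleWord j)) ⟩
    length (map suc (cycleWord j)) ℕ.+ 1          ≡⟨ ≡.cong (ℕ._+ 1) (≡.trans (length-map suc (cycleWord j)) (length-cycleWord j)) ⟩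
    toℕ j ℕ.+ 1                                   ≡⟨ ℕ.+-comm (toℕ j) 1 ⟩
    suc (toℕ j)                                   ∎
    where open ≡.≡-Reasoning

  codeWord : ∀ {m} → LehmerCode (suc m) → Word m
  codeWord {zero}  _       = []
  codeWord {suc m} (j , π) = cycleWord j ++ map suc (codeWord π)

  apply-codeWord : ∀ {m} (π : LehmerCode (suc m)) x → apply (codeWord π) x ≡ decode π x
  apply-codeWord {zero}  (zero , tt) zero = ≡.refl
  apply-codeWord {suc m} (j , π) x = begin
    apply (cycleWord j ++ map suc (codeWord π)) x                 ≡⟨ apply-++ (cycleWord j) _ x ⟩
    apply (cycleWord j) (apply (map suc (codeWord π)) x)          ≡⟨ ≡.cong (apply (cycleWord j)) (apply-map-suc (codeWord π) x) ⟩
    apply (cycleWord j) (Fin.lift 1 (apply (codeWord π)) x)       ≡⟨ apply-cycleWord j _ ⟩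
    decode (j , identityCode) (Fin.lift 1 (apply (codeWord π)) x) ≡⟨ composite x ⟩
    decode (j , π) x                                              ∎
    where
    open ≡.≡-Reasoning
    composite : ∀ x → decode (j , identityCode) (Fin.lift 1 (apply (codeWord π)) x) ≡ decode (j , π) x
    composite zero    = ≡.refl
    composite (suc r) = ≡.cong (punchIn j) (≡.trans (decode-identityCode _) (apply-codeWord π r))

  length-codeWord : ∀ {m} (π : LehmerCode (suc m)) → length (codeWord π) ≡ inversions π
  length-codeWord {zero}  (zero , tt) = ≡.refl
  length-codeWord {suc m} (j , π)     = ≡.trans (length-++ (cycleWord j))
    (≡.cong₂ ℕ._+_ (length-cycleWord j) (≡.trans (length-map suc (codeWord π)) (length-codeWord π)))

module BigOperators {c ℓ : Level} (R : CommutativeRing c ℓ) where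
  open import Data.Nat as ℕ using (ℕ; zero; suc)
  open import Data.Fin using (Fin; zero; suc; toℕ; punchIn)
  open import Data.Fin.Properties using (_≟_; punchInᵢ≢i)
  import Data.Fin.Permutation as Perm
  open import Data.Fin.Permutation.Components using (transpose)
  open import Data.Vec.Functional using (updateAt)
  open import Data.Vec.Functional.Properties using (updateAt-updates; updateAt-minimal)
  open import Function using (_∘_)
  open import Relation.Nullary using (yes; no)
  open import Relation.Binary.PropositionalEquality as ≡ using (_≡_; _≢_)
  open import Defs using (sumR; prodR; signR)
  import Algebra.Properties.Ring
  import Algebra.Properties.CommutativeSemigroup
  import Algebra.Properties.Semiring.Sum
  import Algebra.Properties.CommutativeMonoid.Sum
  import Relation.Binary.Reasoning.Setoid

  open CommutativeRing R hiding (zero)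
  open Relation.Binary.Reasoning.Setoid setoid
  open Algebra.Properties.Ring ring public
    using (-‿distribˡ-*; -‿distribʳ-*; -‿involutive; -1*x≈-x; -0#≈0#; -‿+-comm; +-inverseˡ-unique)
  open Algebra.Properties.CommutativeSemigroup *-commutativeSemigroup public
    using (interchange; x∙yz≈y∙xz)
  open Algebra.Properties.CommutativeSemigroup +-commutativeSemigroup public
    using () renaming (interchange to +-interchange)
  private
    module Sum = Algebra.Properties.Semiring.Sum semiring
    module Product = Algebra.Properties.CommutativeMonoid.Sum *-commutativeMonoid

  -- Opaque, so that ∑ f ≈ ∑ g determines f and g during unification.
  opaque
    ∑ : ∀ {m} → (Fin m → Carrier) → Carrier
    ∑ = Sum.sum

    ∏ : ∀ {m} → (Fin m → Carrier) → Carrier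
    ∏ = Product.sum

  opaque
    unfolding ∑ ∏

    sumR≡∑ : ∀ {m} (f : Fin m → Carrier) → sumR R f ≡ ∑ f
    sumR≡∑ {zero}  f = ≡.refl
    sumR≡∑ {suc m} f = ≡.cong (f zero +_) (sumR≡∑ (f ∘ suc))

    prodR≡∏ : ∀ {m} (f : Fin m → Carrier) → prodR R f ≡ ∏ f
    prodR≡∏ {zero}  f = ≡.refl
    prodR≡∏ {suc m} f = ≡.cong (f zero *_) (prodR≡∏ (f ∘ suc))

    ∑-empty : (f : Fin 0 → Carrier) → ∑ f ≈ 0#
    ∑-empty f = refl

    ∑-suc : ∀ {m} (f : Fin (suc m) → Carrier) → ∑ f ≈ f zero + ∑ (f ∘ suc)
    ∑-suc f = refl

    ∑-cong : ∀ {m} {f g : Fin m → Carrier} → (∀ i → f i ≈ g i) → ∑ f ≈ ∑ g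
    ∑-cong = Sum.sum-cong-≋

    ∑-zero : ∀ {m} {f : Fin m → Carrier} → (∀ i → f i ≈ 0#) → ∑ f ≈ 0#
    ∑-zero {m} f≈0 = trans (Sum.sum-cong-≋ f≈0) (Sum.sum-replicate-zero m)

    ∑-distrib-+ : ∀ {m} (f g : Fin m → Carrier) → ∑ (λ i → f i + g i) ≈ ∑ f + ∑ g
    ∑-distrib-+ = Sum.∑-distrib-+

    ∑-comm : ∀ {m k} (f : Fin m → Fin k → Carrier) → ∑ (λ i → ∑ (f i)) ≈ ∑ (λ j → ∑ (λ i → f i j))
    ∑-comm = Sum.∑-comm

    ∑-remove : ∀ {m} (i : Fin (suc m)) (f : Fin (suc m) → Carrier) → ∑ f ≈ f i + ∑ (f ∘ punchIn i)
    ∑-remove i f = Sum.sum-remove {i = i} f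

    ∑-transpose : ∀ {m} (i j : Fin m) (f : Fin m → Carrier) → ∑ f ≈ ∑ (f ∘ transpose i j)
    ∑-transpose i j f = Sum.sum-permute f (Perm.transpose i j)

    *-distribˡ-∑ : ∀ {m} (x : Carrier) (f : Fin m → Carrier) → x * ∑ f ≈ ∑ (λ i → x * f i)
    *-distribˡ-∑ = Sum.*-distribˡ-sum

    *-distribʳ-∑ : ∀ {m} (x : Carrier) (f : Fin m → Carrier) → ∑ f * x ≈ ∑ (λ i → f i * x)
    *-distribʳ-∑ = Sum.*-distribʳ-sum

    -‿distrib-∑ : ∀ {m} (f : Fin m → Carrier) → - ∑ f ≈ ∑ (λ i → - f i)
    -‿distrib-∑ {zero}  f = -0#≈0#
    -‿distrib-∑ {suc m} f = trans (sym (-‿+-comm _ _)) (+-congˡ (-‿distrib-∑ (f ∘ suc)))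

    ∏-empty : (f : Fin 0 → Carrier) → ∏ f ≈ 1#
    ∏-empty f = refl

    ∏-suc : ∀ {m} (f : Fin (suc m) → Carrier) → ∏ f ≈ f zero * ∏ (f ∘ suc)
    ∏-suc f = refl

    ∏-cong : ∀ {m} {f g : Fin m → Carrier} → (∀ i → f i ≈ g i) → ∏ f ≈ ∏ g
    ∏-cong = Product.sum-cong-≋

    ∏-one : ∀ {m} {f : Fin m → Carrier} → (∀ i → f i ≈ 1#) → ∏ f ≈ 1#
    ∏-one {m} f≈1 = trans (Product.sum-cong-≋ f≈1) (Product.sum-replicate-zero m)

    ∏-distrib-* : ∀ {m} (f g : Fin m → Carrier) → ∏ (λ i → f i * g i) ≈ ∏ f * ∏ g
    ∏-distrib-* = Product.∑-distrib-+

    ∏-remove : ∀ {m} (i : Fin (suc m)) (f : Fin (suc m) → Carrier) → ∏ f ≈ f i * ∏ (f ∘ punchIn i)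
    ∏-remove i f = Product.sum-remove {i = i} f

  infixl 6 _[_]≔_

  _[_]≔_ : ∀ {a} {A : Set a} {m} → (Fin m → A) → Fin m → A → Fin m → A
  f [ i ]≔ x = updateAt f i (λ _ → x)

  []≔-at : ∀ {a} {A : Set a} {m} (f : Fin m → A) i {x} → (f [ i ]≔ x) i ≡ x
  []≔-at f i = updateAt-updates i f

  []≔-elsewhere : ∀ {a} {A : Set a} {m} (f : Fin m → A) {i k} {x} → k ≢ i → (f [ i ]≔ x) k ≡ f k
  []≔-elsewhere f {i} {k} = updateAt-minimal k i f

  []≔-cong : ∀ {m} (i : Fin m) {f g : Fin m → Carrier} {x} k → (k ≢ i → f k ≈ g k) → (f [ i ]≔ x) k ≈ (g [ i ]≔ x) k
  []≔-cong i {f} {g} k f≈g with k ≟ i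
  ... | yes ≡.refl = reflexive (≡.trans ([]≔-at f k) (≡.sym ([]≔-at g k)))
  ... | no k≢i     = trans (reflexive ([]≔-elsewhere f k≢i)) (trans (f≈g k≢i) (reflexive (≡.sym ([]≔-elsewhere g k≢i))))

  ∑-extract : ∀ {m} (i : Fin m) (f : Fin m → Carrier) → ∑ f ≈ f i + ∑ (f [ i ]≔ 0#)
  ∑-extract {suc m} i f = begin
    ∑ f                                                     ≈⟨ ∑-remove i f ⟩
    f i + ∑ (f ∘ punchIn i)                                 ≈⟨ +-congˡ (∑-cong (λ k → reflexive ([]≔-elsewhere f (punchInᵢ≢i i k)))) ⟨
    f i + ∑ ((f [ i ]≔ 0#) ∘ punchIn i)                     ≈⟨ +-congˡ (+-identityˡ _) ⟨
    f i + (0# + ∑ ((f [ i ]≔ 0#) ∘ punchIn i))              ≈⟨ +-congˡ (+-congʳ (reflexive ([]≔-at f i))) ⟨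
    f i + ((f [ i ]≔ 0#) i + ∑ ((f [ i ]≔ 0#) ∘ punchIn i)) ≈⟨ +-congˡ (∑-remove i (f [ i ]≔ 0#)) ⟨
    f i + ∑ (f [ i ]≔ 0#)                                   ∎

  ∏-extract : ∀ {m} (i : Fin m) (f : Fin m → Carrier) → ∏ f ≈ f i * ∏ (f [ i ]≔ 1#)
  ∏-extract {suc m} i f = begin
    ∏ f                                                     ≈⟨ ∏-remove i f ⟩
    f i * ∏ (f ∘ punchIn i)                                 ≈⟨ *-congˡ (∏-cong (λ k → reflexive ([]≔-elsewhere f (punchInᵢ≢i i k)))) ⟨
    f i * ∏ ((f [ i ]≔ 1#) ∘ punchIn i)                     ≈⟨ *-congˡ (*-identityˡ _) ⟨
    f i * (1# * ∏ ((f [ i ]≔ 1#) ∘ punchIn i))              ≈⟨ *-congˡ (*-congʳ (reflexive ([]≔-at f i))) ⟨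
    f i * ((f [ i ]≔ 1#) i * ∏ ((f [ i ]≔ 1#) ∘ punchIn i)) ≈⟨ *-congˡ (∏-remove i (f [ i ]≔ 1#)) ⟨
    f i * ∏ (f [ i ]≔ 1#)                                   ∎

  ∏-scale-at : ∀ {m} (i : Fin m) {f g : Fin m → Carrier} {a : Carrier} →
               (∀ k → k ≢ i → g k ≈ f k) → g i ≈ a * f i → ∏ g ≈ a * ∏ f
  ∏-scale-at i {f} {g} {a} elsewhere at-i = begin
    ∏ g                         ≈⟨ ∏-extract i g ⟩
    g i * ∏ (g [ i ]≔ 1#)       ≈⟨ *-cong at-i (∏-cong (λ k → []≔-cong i k (elsewhere k))) ⟩
    (a * f i) * ∏ (f [ i ]≔ 1#) ≈⟨ *-assoc a (f i) _ ⟩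
    a * (f i * ∏ (f [ i ]≔ 1#)) ≈⟨ *-congˡ (∏-extract i f) ⟨
    a * ∏ f                     ∎

  ∏-add-at : ∀ {m} (i : Fin m) {f g h : Fin m → Carrier} →
             (∀ k → k ≢ i → g k ≈ f k) → (∀ k → k ≢ i → h k ≈ f k) → f i ≈ g i + h i → ∏ f ≈ ∏ g + ∏ h
  ∏-add-at i {f} {g} {h} g-elsewhere h-elsewhere at-i = begin
    ∏ f                                           ≈⟨ ∏-extract i f ⟩
    f i * ∏ (f [ i ]≔ 1#)                         ≈⟨ *-congʳ at-i ⟩
    (g i + h i) * ∏ (f [ i ]≔ 1#)                 ≈⟨ distribʳ _ (g i) (h i) ⟩
    g i * ∏ (f [ i ]≔ 1#) + h i * ∏ (f [ i ]≔ 1#) ≈⟨ +-cong (*-congˡ (∏-cong (λ k → []≔-cong i k (g-elsewhere k))))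
                                                                   (*-congˡ (∏-cong (λ k → []≔-cong i k (h-elsewhere k)))) ⟨
    g i * ∏ (g [ i ]≔ 1#) + h i * ∏ (h [ i ]≔ 1#) ≈⟨ +-cong (∏-extract i g) (∏-extract i h) ⟨
    ∏ g + ∏ h                                     ∎

  ∏-extract₂ : ∀ {m} {i j : Fin m} → i ≢ j → (f : Fin m → Carrier) → ∏ f ≈ (f i * f j) * ∏ ((f [ i ]≔ 1#) [ j ]≔ 1#)
  ∏-extract₂ {i = i} {j} i≢j f = begin
    ∏ f                                ≈⟨ ∏-extract i f ⟩
    f i * ∏ (f [ i ]≔ 1#)              ≈⟨ *-congˡ (∏-extract j (f [ i ]≔ 1#)) ⟩
    f i * ((f [ i ]≔ 1#) j * ∏ rest)   ≡⟨ ≡.cong (λ x → f i * (x * ∏ rest)) ([]≔-elsewhere f (i≢j ∘ ≡.sym)) ⟩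
    f i * (f j * ∏ rest)               ≈⟨ *-assoc (f i) (f j) _ ⟨
    (f i * f j) * ∏ rest               ∎
    where rest = (f [ i ]≔ 1#) [ j ]≔ 1#

  []≔₂-cong : ∀ {m} {i j : Fin m} {f g : Fin m → Carrier} → (∀ k → k ≢ i → k ≢ j → f k ≈ g k) →
                  ∀ k → ((f [ i ]≔ 1#) [ j ]≔ 1#) k ≈ ((g [ i ]≔ 1#) [ j ]≔ 1#) k
  []≔₂-cong {i = i} {j} f≈g k = []≔-cong j k (λ k≢j → []≔-cong i k (λ k≢i → f≈g k k≢i k≢j))

  sign : ℕ → Carrier
  sign zero    = 1#
  sign (suc k) = - sign k

  signR≈sign : ∀ {m} (j : Fin m) → signR R j ≈ sign (toℕ j)
  signR≈sign zero    = refl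
  signR≈sign (suc j) = -‿cong (signR≈sign j)

  sign-+ : ∀ a b → sign (a ℕ.+ b) ≈ sign a * sign b
  sign-+ zero    b = sym (*-identityˡ _)
  sign-+ (suc a) b = trans (-‿cong (sign-+ a b)) (-‿distribˡ-* _ _)

  sign-square : ∀ a → sign a * sign a ≈ 1#
  sign-square zero    = *-identityˡ 1#
  sign-square (suc a) = begin
    - sign a * - sign a     ≈⟨ -‿distribˡ-* _ _ ⟨
    - (sign a * - sign a)   ≈⟨ -‿cong (-‿distribʳ-* _ _) ⟨
    - (- (sign a * sign a)) ≈⟨ -‿involutive _ ⟩
    sign a * sign a         ≈⟨ sign-square a ⟩
    1#                      ∎

module Determinant {c ℓ : Level} (R : CommutativeRing c ℓ) where
  open import Data.Nat as ℕ using (ℕ; zero; suc)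
  import Data.Nat.Properties as ℕ
  open import Data.Fin using (Fin; zero; suc; toℕ; inject₁; punchIn; punchOut)
  open import Data.Fin.Properties using (_≟_; toℕ-injective; toℕ-inject₁; punchInᵢ≢i; punchIn-punchOut; punchOut-punchIn; punchOut-cong; punchIn-injective)
  open import Data.Fin.Permutation.Components using (transpose)
  open import Data.Vec.Functional.Properties using (updateAt-id-local)
  open import Data.List using ([]; _∷_; length)
  open import Data.Sum using (inj₁; inj₂)
  open import Data.Product using (Σ-syntax; _,_; proj₁; proj₂)
  open import Data.Empty using (⊥-elim)
  open import Function using (_∘_)
  open import Relation.Nullary using (yes; no)
  open import Relation.Binary.Definitions using (tri<; tri≈; tri>)
  open import Relation.Binary.PropositionalEquality as ≡ using (_≡_; _≢_)
  open import Defs using (det)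
  open Transpositions
  open LehmerCodes
  import Relation.Binary.Reasoning.Setoid

  open CommutativeRing R hiding (zero)
  open BigOperators R
  open Relation.Binary.Reasoning.Setoid setoid

  Matrix : ℕ → Set c
  Matrix m = Fin m → Fin m → Carrier

  minor : ∀ {m} → Fin (suc m) → Matrix (suc m) → Matrix m
  minor j M r s = M (suc r) (punchIn j s)

  opaque
    Det : ∀ {m} → Matrix m → Carrier
    Det = det R

  cofactorTerm : ∀ {m} → Matrix (suc m) → Fin (suc m) → Carrier
  cofactorTerm M j = sign (toℕ j) * (M zero j * Det (minor j M))

  opaque
    unfolding Det

    det≡Det : ∀ {m} (M : Matrix m) → det R M ≡ Det M
    det≡Det M = ≡.refl

    det-empty : (M : Matrix 0) → Det M ≈ 1#
    det-empty M = refl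

    laplace : ∀ {m} (M : Matrix (suc m)) → Det M ≈ ∑ (cofactorTerm M)
    laplace M = trans (reflexive (sumR≡∑ _)) (∑-cong λ j → *-congʳ (signR≈sign j))

  det-cong : ∀ {m} {M N : Matrix m} → (∀ r s → M r s ≈ N r s) → Det M ≈ Det N
  det-cong {zero} {M} {N} M≈N = trans (det-empty M) (sym (det-empty N))
  det-cong {suc m} {M} {N} M≈N = begin
    Det M              ≈⟨ laplace M ⟩
    ∑ (cofactorTerm M) ≈⟨ ∑-cong (λ j → *-congˡ (*-cong (M≈N zero j) (det-cong (λ r s → M≈N (suc r) (punchIn j s))))) ⟩
    ∑ (cofactorTerm N) ≈⟨ laplace N ⟨
    Det N              ∎

  det-cong≡ : ∀ {m} {M N : Matrix m} → (∀ r s → M r s ≡ N r s) → Det M ≈ Det N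
  det-cong≡ M≡N = det-cong (λ r s → reflexive (M≡N r s))

  sign-neighbours : ∀ {m} {a b : Fin m} → Neighbours a b → sign (toℕ a) ≈ - sign (toℕ b)
  sign-neighbours (inj₁ a≡1+b) = reflexive (≡.cong sign a≡1+b)
  sign-neighbours (inj₂ b≡1+a) = trans (sym (-‿involutive _)) (-‿cong (reflexive (≡.cong sign (≡.sym b≡1+a))))

  ∑-adjacentSwap : ∀ {m} (t : Fin m) (f : Fin (suc m) → Carrier) → ∑ f ≈ ∑ (f ∘ adjacentSwap t)
  ∑-adjacentSwap t f = trans (∑-transpose (inject₁ t) (suc t) f)
    (∑-cong (λ j → reflexive (≡.cong f (≡.sym (adjacentSwap≡transpose t j)))))

  det-adjacentSwap-columns : ∀ {m} (t : Fin m) (M : Matrix (suc m)) →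
                             Det (λ r s → M r (adjacentSwap t s)) ≈ - Det M
  det-adjacentSwap-columns {suc m} t M = begin
    Det M′                               ≈⟨ laplace M′ ⟩
    ∑ (cofactorTerm M′)                  ≈⟨ ∑-adjacentSwap t (cofactorTerm M′) ⟩
    ∑ (cofactorTerm M′ ∘ adjacentSwap t) ≈⟨ ∑-cong term ⟩
    ∑ (λ j → - cofactorTerm M j)         ≈⟨ -‿distrib-∑ (cofactorTerm M) ⟨
    - ∑ (cofactorTerm M)                 ≈⟨ -‿cong (laplace M) ⟨
    - Det M                              ∎
    where
    M′ : Matrix (suc (suc m))
    M′ r s = M r (adjacentSwap t s)
    term : ∀ j → cofactorTerm M′ (adjacentSwap t j) ≈ - cofactorTerm M j
    term j with swapAtColumn t j
    ... | moves neighbours e = begin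
      sign (toℕ (adjacentSwap t j)) * (M zero (adjacentSwap t (adjacentSwap t j)) * Det (minor (adjacentSwap t j) M′))
        ≈⟨ *-cong (sign-neighbours neighbours)
                  (*-cong (reflexive (≡.cong (M zero) (adjacentSwap-involutive t j)))
                          (det-cong≡ (λ r s → ≡.cong (M (suc r)) (e s)))) ⟩
      - sign (toℕ j) * (M zero j * Det (minor j M)) ≈⟨ -‿distribˡ-* _ _ ⟨
      - cofactorTerm M j                            ∎
    ... | fixes e t′ e′ = begin
      sign (toℕ (adjacentSwap t j)) * (M zero (adjacentSwap t (adjacentSwap t j)) * Det (minor (adjacentSwap t j) M′))
        ≡⟨ ≡.cong (λ k → sign (toℕ k) * (M zero (adjacentSwap t k) * Det (minor k M′))) e ⟩
      sign (toℕ j) * (M zero (adjacentSwap t j) * Det (minor j M′))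
        ≈⟨ *-congˡ (*-cong (reflexive (≡.cong (M zero) e)) (det-cong≡ (λ r s → ≡.cong (M (suc r)) (e′ s)))) ⟩
      sign (toℕ j) * (M zero j * Det (λ r s → minor j M r (adjacentSwap t′ s)))
        ≈⟨ *-congˡ (*-congˡ (det-adjacentSwap-columns t′ (minor j M))) ⟩
      sign (toℕ j) * (M zero j * - Det (minor j M)) ≈⟨ *-congˡ (-‿distribʳ-* _ _) ⟨
      sign (toℕ j) * - (M zero j * Det (minor j M)) ≈⟨ -‿distribʳ-* _ _ ⟨
      - cofactorTerm M j                            ∎

  det-apply-columns : ∀ {m} (ts : Word m) (M : Matrix (suc m)) →
                      Det (λ r s → M r (apply ts s)) ≈ sign (length ts) * Det M
  det-apply-columns []       M = sym (*-identityˡ _)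
  det-apply-columns (t ∷ ts) M = begin
    Det (λ r s → M r (adjacentSwap t (apply ts s)))         ≈⟨ det-apply-columns ts (λ r s → M r (adjacentSwap t s)) ⟩
    sign (length ts) * Det (λ r s → M r (adjacentSwap t s)) ≈⟨ *-congˡ (det-adjacentSwap-columns t M) ⟩
    sign (length ts) * - Det M                              ≈⟨ -‿distribʳ-* _ _ ⟨
    - (sign (length ts) * Det M)                            ≈⟨ -‿distribˡ-* _ _ ⟩
    - sign (length ts) * Det M                              ∎

  det-decode-columns : ∀ {m} (π : LehmerCode m) (M : Matrix m) →
                       Det (λ r s → M r (decode π s)) ≈ sign (inversions π) * Det M
  det-decode-columns {zero}  π M = trans (det-cong≡ (λ ())) (sym (*-identityˡ _))
  det-decode-columns {suc m} π M = begin
    Det (λ r s → M r (decode π s))           ≈⟨ det-cong≡ (λ r s → ≡.cong (M r) (≡.sym (apply-codeWord π s))) ⟩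
    Det (λ r s → M r (apply (codeWord π) s)) ≈⟨ det-apply-columns (codeWord π) M ⟩
    sign (length (codeWord π)) * Det M       ≡⟨ ≡.cong (λ k → sign k * Det M) (length-codeWord π) ⟩
    sign (inversions π) * Det M              ∎

  private
    -- Induction on k = toℕ b, using (a b) = (a b′) (b′ b) (a b′) for b′ = b - 1.
    det-transpose-columns-< : ∀ {m} k {a b : Fin (suc m)} → toℕ b ≡ k → toℕ a ℕ.< toℕ b → (M : Matrix (suc m)) →
                              Det (λ r s → M r (transpose a b s)) ≈ - Det M
    det-transpose-columns-< k       {b = zero}   _  () M
    det-transpose-columns-< {m} (suc k) {a} {suc b} b≡k a<b M with a ≟ inject₁ b
    ... | yes ≡.refl = begin
      Det (λ r s → M r (transpose (inject₁ b) (suc b) s)) ≈⟨ det-cong≡ (λ r s → ≡.cong (M r) (≡.sym (adjacentSwap≡transpose b s))) ⟩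
      Det (λ r s → M r (adjacentSwap b s))                ≈⟨ det-adjacentSwap-columns b M ⟩
      - Det M                                             ∎
    ... | no a≢b′ = begin
      Det (λ r s → M r (transpose a (suc b) s)) ≈⟨ det-cong≡ (λ r s → ≡.cong (M r) (transpose-conj a≢1+b a≢b′ 1+b≢b′ s)) ⟩
      Det (λ r s → M₂ r (transpose a b′ s))     ≈⟨ IH M₂ ⟩
      - Det M₂                                  ≈⟨ -‿cong (det-cong≡ (λ r s → ≡.cong (M₁ r) (≡.sym (adjacentSwap≡transpose b s)))) ⟩
      - Det (λ r s → M₁ r (adjacentSwap b s))   ≈⟨ -‿cong (det-adjacentSwap-columns b M₁) ⟩
      - (- Det M₁)                              ≈⟨ -‿involutive _ ⟩
      Det M₁                                    ≈⟨ IH M ⟩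
      - Det M                                   ∎
      where
      b′ = inject₁ b
      toℕb′ : toℕ b′ ≡ toℕ b
      toℕb′ = toℕ-inject₁ b
      a≢1+b : a ≢ suc b
      a≢1+b a≡1+b = ℕ.<-irrefl (≡.cong toℕ a≡1+b) a<b
      1+b≢b′ : suc b ≢ b′
      1+b≢b′ e = ℕ.<-irrefl (≡.sym (≡.trans (≡.cong toℕ e) toℕb′)) (ℕ.n<1+n (toℕ b))
      a<b′ : toℕ a ℕ.< toℕ b′
      a<b′ with ℕ.m≤n⇒m<n∨m≡n (ℕ.≤-pred a<b)
      ... | inj₁ a<b = ≡.subst (toℕ a ℕ.<_) (≡.sym toℕb′) a<b
      ... | inj₂ a≡b = ⊥-elim (a≢b′ (toℕ-injective (≡.trans a≡b (≡.sym toℕb′))))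
      IH : (N : Matrix (suc m)) → Det (λ r s → N r (transpose a b′ s)) ≈ - Det N
      IH = det-transpose-columns-< k (≡.trans toℕb′ (ℕ.suc-injective b≡k)) a<b′
      M₁ M₂ : Matrix (suc m)
      M₁ r s = M r (transpose a b′ s)
      M₂ r s = M₁ r (transpose b′ (suc b) s)

  det-transpose-columns : ∀ {m} {a b : Fin m} → a ≢ b → (M : Matrix m) →
                          Det (λ r s → M r (transpose a b s)) ≈ - Det M
  det-transpose-columns {suc m} {a} {b} a≢b M with ℕ.<-cmp (toℕ a) (toℕ b)
  ... | tri< a<b _ _ = det-transpose-columns-< (toℕ b) ≡.refl a<b M
  ... | tri≈ _ a≡b _ = ⊥-elim (a≢b (toℕ-injective a≡b))
  ... | tri> _ _ b<a = trans (det-cong≡ (λ r s → ≡.cong (M r) (transpose-comm a b s)))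
                             (det-transpose-columns-< (toℕ a) ≡.refl b<a M)

  withColumn : ∀ {m} → Fin m → (Fin m → Carrier) → Matrix m → Matrix m
  withColumn c x M r = M r [ c ]≔ x r

  withColumn-at : ∀ {m} (c : Fin m) x M r → withColumn c x M r c ≡ x r
  withColumn-at c x M r = []≔-at (M r) c

  withColumn-elsewhere : ∀ {m} {c s : Fin m} x M r → s ≢ c → withColumn c x M r s ≡ M r s
  withColumn-elsewhere x M r = []≔-elsewhere (M r)

  minor-withColumn-at : ∀ {m} (c : Fin (suc m)) x M r s → minor c (withColumn c x M) r s ≡ minor c M r s
  minor-withColumn-at c x M r s = withColumn-elsewhere x M (suc r) (punchInᵢ≢i c s)

  minor-withColumn : ∀ {m} {j c : Fin (suc m)} (j≢c : j ≢ c) x M r s →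
                     minor j (withColumn c x M) r s ≡ withColumn (punchOut j≢c) (x ∘ suc) (minor j M) r s
  minor-withColumn {j = j} {c} j≢c x M r s with s ≟ punchOut j≢c
  ... | yes ≡.refl = ≡.trans (≡.cong (withColumn c x M (suc r)) (punchIn-punchOut j≢c))
                             (≡.trans (withColumn-at c x M (suc r)) (≡.sym (withColumn-at _ (x ∘ suc) (minor j M) r)))
  ... | no s≢c′ = ≡.trans (withColumn-elsewhere x M (suc r) punchIn≢c)
                          (≡.sym (withColumn-elsewhere (x ∘ suc) (minor j M) r s≢c′))
    where
    punchIn≢c : punchIn j s ≢ c
    punchIn≢c e = s≢c′ (punchIn-injective j s _ (≡.trans e (≡.sym (punchIn-punchOut j≢c))))

  det-withColumn-+ : ∀ {m} (c : Fin m) (x y : Fin m → Carrier) (M : Matrix m) →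
                     Det (withColumn c (λ r → x r + y r) M) ≈ Det (withColumn c x M) + Det (withColumn c y M)
  det-withColumn-+ {suc m} c x y M = begin
    Det (withColumn c x+y M)                                                        ≈⟨ laplace _ ⟩
    ∑ (cofactorTerm (withColumn c x+y M))                                           ≈⟨ ∑-cong term ⟩
    ∑ (λ j → cofactorTerm (withColumn c x M) j + cofactorTerm (withColumn c y M) j) ≈⟨ ∑-distrib-+ _ _ ⟩
    ∑ (cofactorTerm (withColumn c x M)) + ∑ (cofactorTerm (withColumn c y M))       ≈⟨ +-cong (laplace _) (laplace _) ⟨
    Det (withColumn c x M) + Det (withColumn c y M)                                 ∎
    where
    x+y : Fin (suc m) → Carrier
    x+y r = x r + y r
    term : ∀ j → cofactorTerm (withColumn c x+y M) j ≈
                 cofactorTerm (withColumn c x M) j + cofactorTerm (withColumn c y M) j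
    term j with j ≟ c
    ... | yes ≡.refl = begin
      sign (toℕ j) * (withColumn j x+y M zero j * Det (minor j (withColumn j x+y M)))
        ≈⟨ *-congˡ (*-cong (reflexive (withColumn-at j x+y M zero)) (det-cong≡ (minor-withColumn-at j x+y M))) ⟩
      sign (toℕ j) * ((x zero + y zero) * Det (minor j M))
        ≈⟨ trans (*-congˡ (distribʳ _ _ _)) (distribˡ _ _ _) ⟩
      sign (toℕ j) * (x zero * Det (minor j M)) + sign (toℕ j) * (y zero * Det (minor j M))
        ≈⟨ +-cong (*-congˡ (*-cong (reflexive (withColumn-at j x M zero)) (det-cong≡ (minor-withColumn-at j x M))))
                  (*-congˡ (*-cong (reflexive (withColumn-at j y M zero)) (det-cong≡ (minor-withColumn-at j y M)))) ⟨
      cofactorTerm (withColumn j x M) j + cofactorTerm (withColumn j y M) j ∎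
    ... | no j≢c = begin
      sign (toℕ j) * (withColumn c x+y M zero j * Det (minor j (withColumn c x+y M)))
        ≈⟨ *-congˡ (*-cong (reflexive (withColumn-elsewhere x+y M zero j≢c))
                           (trans (det-cong≡ (minor-withColumn j≢c x+y M))
                                  (det-withColumn-+ (punchOut j≢c) (x ∘ suc) (y ∘ suc) (minor j M)))) ⟩
      sign (toℕ j) * (M zero j * (Det (withColumn c′ (x ∘ suc) (minor j M)) + Det (withColumn c′ (y ∘ suc) (minor j M))))
        ≈⟨ trans (*-congˡ (distribˡ _ _ _)) (distribˡ _ _ _) ⟩
      sign (toℕ j) * (M zero j * Det (withColumn c′ (x ∘ suc) (minor j M))) +
      sign (toℕ j) * (M zero j * Det (withColumn c′ (y ∘ suc) (minor j M)))
        ≈⟨ +-cong (*-congˡ (*-cong (reflexive (withColumn-elsewhere x M zero j≢c)) (det-cong≡ (minor-withColumn j≢c x M))))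
                  (*-congˡ (*-cong (reflexive (withColumn-elsewhere y M zero j≢c)) (det-cong≡ (minor-withColumn j≢c y M)))) ⟨
      cofactorTerm (withColumn c x M) j + cofactorTerm (withColumn c y M) j ∎
      where c′ = punchOut j≢c

  det-withColumn-* : ∀ {m} (c : Fin m) (a : Carrier) (x : Fin m → Carrier) (M : Matrix m) →
                     Det (withColumn c (λ r → a * x r) M) ≈ a * Det (withColumn c x M)
  det-withColumn-* {suc m} c a x M = begin
    Det (withColumn c ax M)                         ≈⟨ laplace _ ⟩
    ∑ (cofactorTerm (withColumn c ax M))            ≈⟨ ∑-cong term ⟩
    ∑ (λ j → a * cofactorTerm (withColumn c x M) j) ≈⟨ *-distribˡ-∑ a _ ⟨
    a * ∑ (cofactorTerm (withColumn c x M))         ≈⟨ *-congˡ (laplace _) ⟨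
    a * Det (withColumn c x M)                      ∎
    where
    ax : Fin (suc m) → Carrier
    ax r = a * x r
    term : ∀ j → cofactorTerm (withColumn c ax M) j ≈ a * cofactorTerm (withColumn c x M) j
    term j with j ≟ c
    ... | yes ≡.refl = begin
      sign (toℕ j) * (withColumn j ax M zero j * Det (minor j (withColumn j ax M)))
        ≈⟨ *-congˡ (*-cong (reflexive (withColumn-at j ax M zero)) (det-cong≡ (minor-withColumn-at j ax M))) ⟩
      sign (toℕ j) * ((a * x zero) * Det (minor j M))  ≈⟨ trans (*-congˡ (*-assoc _ _ _)) (x∙yz≈y∙xz _ _ _) ⟩
      a * (sign (toℕ j) * (x zero * Det (minor j M)))
        ≈⟨ *-congˡ (*-congˡ (*-cong (reflexive (withColumn-at j x M zero)) (det-cong≡ (minor-withColumn-at j x M)))) ⟨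
      a * cofactorTerm (withColumn j x M) j ∎
    ... | no j≢c = begin
      sign (toℕ j) * (withColumn c ax M zero j * Det (minor j (withColumn c ax M)))
        ≈⟨ *-congˡ (*-cong (reflexive (withColumn-elsewhere ax M zero j≢c))
                           (trans (det-cong≡ (minor-withColumn j≢c ax M))
                                  (det-withColumn-* (punchOut j≢c) a (x ∘ suc) (minor j M)))) ⟩
      sign (toℕ j) * (M zero j * (a * Det (withColumn (punchOut j≢c) (x ∘ suc) (minor j M))))
        ≈⟨ trans (*-congˡ (x∙yz≈y∙xz _ _ _)) (x∙yz≈y∙xz _ _ _) ⟩
      a * (sign (toℕ j) * (M zero j * Det (withColumn (punchOut j≢c) (x ∘ suc) (minor j M))))
        ≈⟨ *-congˡ (*-congˡ (*-cong (reflexive (withColumn-elsewhere x M zero j≢c)) (det-cong≡ (minor-withColumn j≢c x M)))) ⟨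
      a * cofactorTerm (withColumn c x M) j ∎

  punchIn-punchOut-swap : ∀ {m} {a b : Fin (suc (suc m))} (a≢b : a ≢ b) (b≢a : b ≢ a) (s : Fin m) →
                          punchIn a (punchIn (punchOut a≢b) s) ≡ punchIn b (punchIn (punchOut b≢a) s)
  punchIn-punchOut-swap {a = zero}  {zero}  a≢b _ s = ⊥-elim (a≢b ≡.refl)
  punchIn-punchOut-swap {a = zero}  {suc b} _   _ s = ≡.refl
  punchIn-punchOut-swap {a = suc a} {zero}  _   _ s = ≡.refl
  punchIn-punchOut-swap {zero}  {suc zero} {suc zero} a≢b _ s = ⊥-elim (a≢b ≡.refl)
  punchIn-punchOut-swap {suc m} {suc a} {suc b} _ _ zero    = ≡.refl
  punchIn-punchOut-swap {suc m} {suc a} {suc b} a≢b b≢a (suc s) =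
    ≡.cong suc (punchIn-punchOut-swap (a≢b ∘ ≡.cong suc) (b≢a ∘ ≡.cong suc) s)

  sign-punchOut-swap : ∀ {m} {a b : Fin (suc (suc m))} (a≢b : a ≢ b) (b≢a : b ≢ a) →
                       sign (toℕ a) * sign (toℕ (punchOut a≢b)) ≈ - (sign (toℕ b) * sign (toℕ (punchOut b≢a)))
  sign-punchOut-swap {a = zero}  {zero}  a≢b _ = ⊥-elim (a≢b ≡.refl)
  sign-punchOut-swap {a = zero}  {suc b} _   _ = begin
    1# * sign (toℕ b)       ≈⟨ *-identityˡ _ ⟩
    sign (toℕ b)            ≈⟨ -‿involutive _ ⟨
    - (- sign (toℕ b))      ≈⟨ -‿cong (*-identityʳ _) ⟨
    - (- sign (toℕ b) * 1#) ∎
  sign-punchOut-swap {a = suc a} {zero}  _   _ = begin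
    - sign (toℕ a) * 1#   ≈⟨ *-identityʳ _ ⟩
    - sign (toℕ a)        ≈⟨ -‿cong (*-identityˡ _) ⟨
    - (1# * sign (toℕ a)) ∎
  sign-punchOut-swap {zero}  {suc zero} {suc zero} a≢b _ = ⊥-elim (a≢b ≡.refl)
  sign-punchOut-swap {suc m} {suc a} {suc b} a≢b b≢a = begin
    - sign (toℕ a) * - sign (toℕ (punchOut a≢b′))     ≈⟨ -x*-y≈x*y _ _ ⟩
    sign (toℕ a) * sign (toℕ (punchOut a≢b′))         ≈⟨ sign-punchOut-swap a≢b′ b≢a′ ⟩
    - (sign (toℕ b) * sign (toℕ (punchOut b≢a′)))     ≈⟨ -‿cong (-x*-y≈x*y _ _) ⟨
    - (- sign (toℕ b) * - sign (toℕ (punchOut b≢a′))) ∎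
    where
    a≢b′ = a≢b ∘ ≡.cong suc
    b≢a′ = b≢a ∘ ≡.cong suc
    -x*-y≈x*y : ∀ x y → - x * - y ≈ x * y
    -x*-y≈x*y x y = trans (sym (-‿distribˡ-* x (- y))) (trans (-‿cong (sym (-‿distribʳ-* x y))) (-‿involutive _))

  -- Expanding along the first two rows writes the determinant as a sum over ordered pairs of distinct
  -- columns; exchanging the two rows exchanges the pair and flips the sign of each summand.
  module FirstTwoRows {m} (rest : Fin m → Fin (suc (suc m)) → Carrier) where

    stack : (x y : Fin (suc (suc m)) → Carrier) → Matrix (suc (suc m))
    stack x y zero          = x
    stack x y (suc zero)    = y
    stack x y (suc (suc r)) = rest r

    restMinor : Fin (suc (suc m)) → Fin (suc m) → Carrier
    restMinor j k = Det (λ r s → rest r (punchIn j (punchIn k s)))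

    term : (x y : Fin (suc (suc m)) → Carrier) → Fin (suc (suc m)) → Fin (suc m) → Carrier
    term x y j k = sign (toℕ j) * (x j * (sign (toℕ k) * (y (punchIn j k) * restMinor j k)))

    pairTerm : (x y : Fin (suc (suc m)) → Carrier) → Fin (suc (suc m)) → Fin (suc (suc m)) → Carrier
    pairTerm x y a b with a ≟ b
    ... | yes _   = 0#
    ... | no a≢b = term x y a (punchOut a≢b)

    pairTerm-diagonal : ∀ x y a → pairTerm x y a a ≈ 0#
    pairTerm-diagonal x y a with a ≟ a
    ... | yes _   = refl
    ... | no a≢a = ⊥-elim (a≢a ≡.refl)

    pairTerm-punchIn : ∀ x y j k → pairTerm x y j (punchIn j k) ≈ term x y j k
    pairTerm-punchIn x y j k with j ≟ punchIn j k
    ... | yes j≡ = ⊥-elim (punchInᵢ≢i j k (≡.sym j≡))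
    ... | no j≢  = reflexive (≡.cong (term x y j) (≡.trans (punchOut-cong j ≡.refl) (punchOut-punchIn j)))

    ∑-term : ∀ x y j → ∑ (term x y j) ≈ ∑ (pairTerm x y j)
    ∑-term x y j = begin
      ∑ (term x y j)                                    ≈⟨ ∑-cong (pairTerm-punchIn x y j) ⟨
      ∑ (pairTerm x y j ∘ punchIn j)                    ≈⟨ +-identityˡ _ ⟨
      0# + ∑ (pairTerm x y j ∘ punchIn j)               ≈⟨ +-congʳ (pairTerm-diagonal x y j) ⟨
      pairTerm x y j j + ∑ (pairTerm x y j ∘ punchIn j) ≈⟨ ∑-remove j (pairTerm x y j) ⟨
      ∑ (pairTerm x y j)                                ∎

    det-stack : ∀ x y → Det (stack x y) ≈ ∑ (λ a → ∑ (pairTerm x y a))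
    det-stack x y = trans (laplace (stack x y)) (∑-cong λ j → begin
      sign (toℕ j) * (x j * Det (minor j (stack x y)))                        ≈⟨ *-congˡ (*-congˡ (laplace _)) ⟩
      sign (toℕ j) * (x j * ∑ (λ k → sign (toℕ k) * (y (punchIn j k) * restMinor j k)))
        ≈⟨ trans (*-congˡ (*-distribˡ-∑ (x j) _)) (*-distribˡ-∑ (sign (toℕ j)) _) ⟩
      ∑ (term x y j)     ≈⟨ ∑-term x y j ⟩
      ∑ (pairTerm x y j) ∎)

    pairTerm-antisym : ∀ x y a b → pairTerm y x a b ≈ - pairTerm x y b a
    pairTerm-antisym x y a b with a ≟ b | b ≟ a
    ... | yes _   | yes _   = sym -0#≈0#
    ... | yes a≡b | no b≢a = ⊥-elim (b≢a (≡.sym a≡b))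
    ... | no a≢b | yes b≡a = ⊥-elim (a≢b (≡.sym b≡a))
    ... | no a≢b | no b≢a = begin
      sign (toℕ a) * (y a * (sign (toℕ k) * (x (punchIn a k) * restMinor a k)))  ≈⟨ rearrange _ _ _ _ _ ⟩
      (sign (toℕ a) * sign (toℕ k)) * ((y a * x (punchIn a k)) * restMinor a k)
        ≈⟨ *-cong (sign-punchOut-swap a≢b b≢a)
                  (*-cong (trans (*-comm _ _) (reflexive (≡.cong₂ _*_ (≡.cong x (punchIn-punchOut a≢b))
                                                                       (≡.cong y (≡.sym (punchIn-punchOut b≢a))))))
                          (det-cong≡ (λ r s → ≡.cong (rest r) (punchIn-punchOut-swap a≢b b≢a s)))) ⟩
      - (sign (toℕ b) * sign (toℕ k′)) * ((x b * y (punchIn b k′)) * restMinor b k′)   ≈⟨ -‿distribˡ-* _ _ ⟨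
      - ((sign (toℕ b) * sign (toℕ k′)) * ((x b * y (punchIn b k′)) * restMinor b k′)) ≈⟨ -‿cong (rearrange _ _ _ _ _) ⟨
      - (sign (toℕ b) * (x b * (sign (toℕ k′) * (y (punchIn b k′) * restMinor b k′)))) ∎
      where
      k  = punchOut a≢b
      k′ = punchOut b≢a
      rearrange : ∀ s x t y e → s * (x * (t * (y * e))) ≈ (s * t) * ((x * y) * e)
      rearrange s x t y e = begin
        s * (x * (t * (y * e))) ≈⟨ *-congˡ (x∙yz≈y∙xz x t (y * e)) ⟩
        s * (t * (x * (y * e))) ≈⟨ *-assoc s t _ ⟨
        (s * t) * (x * (y * e)) ≈⟨ *-congˡ (*-assoc x y e) ⟨
        (s * t) * ((x * y) * e) ∎

    det-stack-swap : ∀ x y → Det (stack y x) ≈ - Det (stack x y)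
    det-stack-swap x y = begin
      Det (stack y x)                        ≈⟨ det-stack y x ⟩
      ∑ (λ a → ∑ (pairTerm y x a))           ≈⟨ ∑-cong (λ a → ∑-cong (pairTerm-antisym x y a)) ⟩
      ∑ (λ a → ∑ (λ b → - pairTerm x y b a)) ≈⟨ ∑-cong (λ a → -‿distrib-∑ _) ⟨
      ∑ (λ a → - ∑ (λ b → pairTerm x y b a)) ≈⟨ -‿distrib-∑ _ ⟨
      - ∑ (λ a → ∑ (λ b → pairTerm x y b a)) ≈⟨ -‿cong (∑-comm (pairTerm x y)) ⟨
      - ∑ (λ b → ∑ (pairTerm x y b))         ≈⟨ -‿cong (det-stack x y) ⟨
      - Det (stack x y)                      ∎

  det-swap-rows-01 : ∀ {m} (M : Matrix (suc (suc m))) → Det (λ r s → M (transpose zero (suc zero) r) s) ≈ - Det M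
  det-swap-rows-01 M = begin
    Det (λ r s → M (transpose zero (suc zero) r) s) ≈⟨ det-cong≡ swapped ⟩
    Det (stack (M (suc zero)) (M zero))             ≈⟨ det-stack-swap (M zero) (M (suc zero)) ⟩
    - Det (stack (M zero) (M (suc zero)))           ≈⟨ -‿cong (det-cong≡ unswapped) ⟩
    - Det M                                         ∎
    where
    open FirstTwoRows (λ r → M (suc (suc r)))
    swapped : ∀ r s → M (transpose zero (suc zero) r) s ≡ stack (M (suc zero)) (M zero) r s
    swapped zero          s = ≡.refl
    swapped (suc zero)    s = ≡.refl
    swapped (suc (suc r)) s = ≡.refl
    unswapped : ∀ r s → stack (M zero) (M (suc zero)) r s ≡ M r s
    unswapped zero          s = ≡.refl
    unswapped (suc zero)    s = ≡.refl
    unswapped (suc (suc r)) s = ≡.refl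

  mutual
    det-transpose-rows : ∀ {m} {a b : Fin m} → a ≢ b → (M : Matrix m) → Det (λ r s → M (transpose a b r) s) ≈ - Det M
    det-transpose-rows {a = zero}  {zero}  a≢b M = ⊥-elim (a≢b ≡.refl)
    det-transpose-rows {a = zero}  {suc b} _   M = det-transpose-rows-0 b M
    det-transpose-rows {a = suc a} {zero}  _   M =
      trans (det-cong≡ (λ r s → ≡.cong (λ k → M k s) (transpose-comm (suc a) zero r))) (det-transpose-rows-0 a M)
    det-transpose-rows {a = suc a} {suc b} a≢b M = det-transpose-rows-suc (a≢b ∘ ≡.cong suc) M

    private
      det-transpose-rows-suc : ∀ {m} {a b : Fin m} → a ≢ b → (M : Matrix (suc m)) →
                               Det (λ r s → M (transpose (suc a) (suc b) r) s) ≈ - Det M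
      det-transpose-rows-suc {suc m} {a} {b} a≢b M = begin
        Det M′                       ≈⟨ laplace M′ ⟩
        ∑ (cofactorTerm M′)          ≈⟨ ∑-cong term ⟩
        ∑ (λ j → - cofactorTerm M j) ≈⟨ -‿distrib-∑ _ ⟨
        - ∑ (cofactorTerm M)         ≈⟨ -‿cong (laplace M) ⟨
        - Det M                      ∎
        where
        M′ : Matrix (suc (suc m))
        M′ r s = M (transpose (suc a) (suc b) r) s
        term : ∀ j → cofactorTerm M′ j ≈ - cofactorTerm M j
        term j = begin
          sign (toℕ j) * (M zero j * Det (minor j M′))
            ≈⟨ *-congˡ (*-congˡ (det-cong≡ (λ r s → ≡.cong (λ k → M k (punchIn j s)) (transpose-suc a b r)))) ⟩
          sign (toℕ j) * (M zero j * Det (λ r s → minor j M (transpose a b r) s))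
            ≈⟨ *-congˡ (*-congˡ (det-transpose-rows a≢b (minor j M))) ⟩
          sign (toℕ j) * (M zero j * - Det (minor j M)) ≈⟨ trans (*-congˡ (sym (-‿distribʳ-* _ _))) (sym (-‿distribʳ-* _ _)) ⟩
          - cofactorTerm M j                            ∎

      -- (0 b) = (0 1) (1 b) (0 1) when b ≠ 1.
      det-transpose-rows-0 : ∀ {m} (b : Fin m) (M : Matrix (suc m)) → Det (λ r s → M (transpose zero (suc b) r) s) ≈ - Det M
      det-transpose-rows-0 {suc m} zero    M = det-swap-rows-01 M
      det-transpose-rows-0 {suc m} (suc b) M = begin
        Det (λ r s → M (transpose zero (suc (suc b)) r) s)
          ≈⟨ det-cong≡ (λ r s → ≡.cong (λ k → M k s) (transpose-conj (λ ()) (λ ()) (λ ()) r)) ⟩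
        Det (λ r s → M₂ (transpose zero (suc zero) r) s) ≈⟨ det-swap-rows-01 M₂ ⟩
        - Det M₂                                         ≈⟨ -‿cong (det-transpose-rows-suc (λ ()) M₁) ⟩
        - (- Det M₁)                                     ≈⟨ -‿involutive _ ⟩
        Det M₁                                           ≈⟨ det-swap-rows-01 M ⟩
        - Det M                                          ∎
        where
        M₁ M₂ : Matrix (suc (suc m))
        M₁ r s = M (transpose zero (suc zero) r) s
        M₂ r s = M₁ (transpose (suc zero) (suc (suc b)) r) s

  ∑Code : ∀ {m} → (LehmerCode m → Carrier) → Carrier
  ∑Code {zero}  f = f _
  ∑Code {suc m} f = ∑ (λ j → ∑Code (λ π → f (j , π)))

  ∑Code-cong : ∀ {m} {f g : LehmerCode m → Carrier} → (∀ π → f π ≈ g π) → ∑Code f ≈ ∑Code g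
  ∑Code-cong {zero}  f≈g = f≈g _
  ∑Code-cong {suc m} f≈g = ∑-cong (λ j → ∑Code-cong (λ π → f≈g (j , π)))

  *-distribˡ-∑Code : ∀ {m} x (f : LehmerCode m → Carrier) → x * ∑Code f ≈ ∑Code (λ π → x * f π)
  *-distribˡ-∑Code {zero}  x f = refl
  *-distribˡ-∑Code {suc m} x f = trans (*-distribˡ-∑ x _) (∑-cong (λ j → *-distribˡ-∑Code x (λ π → f (j , π))))

  ∑Code-∑ : ∀ {m k} (f : LehmerCode m → Fin k → Carrier) → ∑Code (λ π → ∑ (f π)) ≈ ∑ (λ i → ∑Code (λ π → f π i))
  ∑Code-∑ {zero}  f = refl
  ∑Code-∑ {suc m} f = trans (∑-cong (λ j → ∑Code-∑ (λ π → f (j , π)))) (∑-comm _)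

  leibniz : ∀ {m} (M : Matrix m) → Det M ≈ ∑Code (λ π → sign (inversions π) * ∏ (λ r → M r (decode π r)))
  leibniz {zero}  M = trans (det-empty M) (sym (trans (*-identityˡ _) (∏-empty _)))
  leibniz {suc m} M = trans (laplace M) (∑-cong λ j → begin
    sign (toℕ j) * (M zero j * Det (minor j M))
      ≈⟨ *-congˡ (*-congˡ (leibniz (minor j M))) ⟩
    sign (toℕ j) * (M zero j * ∑Code (λ π → sign (inversions π) * ∏ (λ r → minor j M r (decode π r))))
      ≈⟨ trans (*-congˡ (*-distribˡ-∑Code {m} _ _)) (*-distribˡ-∑Code {m} _ _) ⟩
    ∑Code (λ π → sign (toℕ j) * (M zero j * (sign (inversions π) * ∏ (λ r → minor j M r (decode π r)))))
      ≈⟨ ∑Code-cong (λ π → begin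
        sign (toℕ j) * (M zero j * (sign (inversions π) * ∏ (λ r → minor j M r (decode π r))))
          ≈⟨ *-congˡ (x∙yz≈y∙xz _ _ _) ⟩
        sign (toℕ j) * (sign (inversions π) * (M zero j * ∏ (λ r → minor j M r (decode π r))))
          ≈⟨ *-assoc _ _ _ ⟨
        (sign (toℕ j) * sign (inversions π)) * (M zero j * ∏ (λ r → minor j M r (decode π r)))
          ≈⟨ *-cong (sign-+ (toℕ j) (inversions π)) (∏-suc _) ⟨
        sign (inversions (j , π)) * ∏ (λ r → M r (decode (j , π) r)) ∎) ⟩
    ∑Code (λ π → sign (inversions (j , π)) * ∏ (λ r → M r (decode (j , π) r))) ∎)

  withColumn-self : ∀ {m} (c : Fin m) (M : Matrix m) r s → withColumn c (λ r → M r c) M r s ≡ M r s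
  withColumn-self c M r = updateAt-id-local c (M r) ≡.refl

  det-withColumn-cong : ∀ {m} (c : Fin m) {x y : Fin m → Carrier} (M : Matrix m) → (∀ r → x r ≈ y r) →
                        Det (withColumn c x M) ≈ Det (withColumn c y M)
  det-withColumn-cong c {x} {y} M x≈y = det-cong entries
    where
    entries : ∀ r s → withColumn c x M r s ≈ withColumn c y M r s
    entries r s with s ≟ c
    ... | yes ≡.refl = trans (reflexive (withColumn-at s x M r)) (trans (x≈y r) (reflexive (≡.sym (withColumn-at s y M r))))
    ... | no s≢c     = reflexive (≡.trans (withColumn-elsewhere x M r s≢c) (≡.sym (withColumn-elsewhere y M r s≢c)))

  det-withColumn-∑ : ∀ {m k} (c : Fin m) (a : Fin k → Carrier) (x : Fin k → Fin m → Carrier) (M : Matrix m) →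
                     Det (withColumn c (λ r → ∑ (λ q → a q * x q r)) M) ≈ ∑ (λ q → a q * Det (withColumn c (x q) M))
  det-withColumn-∑ {k = zero} c a x M = begin
    Det (withColumn c (λ r → ∑ (λ q → a q * x q r)) M) ≈⟨ det-withColumn-cong c M (λ r → trans (∑-empty _) (sym (zeroˡ 0#))) ⟩
    Det (withColumn c (λ r → 0# * 0#) M)               ≈⟨ det-withColumn-* c 0# (λ _ → 0#) M ⟩
    0# * Det (withColumn c (λ _ → 0#) M)               ≈⟨ zeroˡ _ ⟩
    0#                                                 ≈⟨ ∑-empty _ ⟨
    ∑ (λ q → a q * Det (withColumn c (x q) M))         ∎
  det-withColumn-∑ {k = suc k} c a x M = begin
    Det (withColumn c (λ r → ∑ (λ q → a q * x q r)) M)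
      ≈⟨ det-withColumn-cong c M (λ r → ∑-suc _) ⟩
    Det (withColumn c (λ r → a zero * x zero r + ∑ (λ q → a (suc q) * x (suc q) r)) M)
      ≈⟨ det-withColumn-+ c _ _ M ⟩
    Det (withColumn c (λ r → a zero * x zero r) M) + Det (withColumn c (λ r → ∑ (λ q → a (suc q) * x (suc q) r)) M)
      ≈⟨ +-cong (det-withColumn-* c (a zero) (x zero) M) (det-withColumn-∑ c (a ∘ suc) (x ∘ suc) M) ⟩
    a zero * Det (withColumn c (x zero) M) + ∑ (λ q → a (suc q) * Det (withColumn c (x (suc q)) M))
      ≈⟨ ∑-suc _ ⟨
    ∑ (λ q → a q * Det (withColumn c (x q) M)) ∎

  TwoInvertible : Set (c ⊔ ℓ)
  TwoInvertible = Σ[ ½ ∈ Carrier ] (1# + 1#) * ½ ≈ 1#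

  module WithTwoInvertible (two⁻¹ : TwoInvertible) where

    private
      ½ = proj₁ two⁻¹
      2*½≈1 = proj₂ two⁻¹

    x≈-x⇒x≈0 : ∀ {x} → x ≈ - x → x ≈ 0#
    x≈-x⇒x≈0 {x} x≈-x = begin
      x                   ≈⟨ *-identityˡ x ⟨
      1# * x              ≈⟨ *-congʳ (trans (sym 2*½≈1) (*-comm _ ½)) ⟩
      (½ * (1# + 1#)) * x ≈⟨ *-assoc ½ _ x ⟩
      ½ * ((1# + 1#) * x) ≈⟨ *-congˡ (trans (distribʳ x 1# 1#) (+-cong (*-identityˡ x) (*-identityˡ x))) ⟩
      ½ * (x + x)         ≈⟨ *-congˡ (trans (+-congˡ x≈-x) (-‿inverseʳ x)) ⟩
      ½ * 0#              ≈⟨ zeroʳ ½ ⟩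
      0#                  ∎

    det-equal-rows : ∀ {m} {a b : Fin m} → a ≢ b → (M : Matrix m) → (∀ s → M a s ≈ M b s) → Det M ≈ 0#
    det-equal-rows {a = a} {b} a≢b M rows≈ = x≈-x⇒x≈0 (trans (det-cong swapped) (det-transpose-rows a≢b M))
      where
      swapped : ∀ r s → M r s ≈ M (transpose a b r) s
      swapped r s with transposeView a b r
      ... | at-i ≡.refl       = trans (rows≈ s) (reflexive (≡.cong (λ k → M k s) (≡.sym (transpose-i r b))))
      ... | at-j ≡.refl _     = trans (sym (rows≈ s)) (reflexive (≡.cong (λ k → M k s) (≡.sym (transpose-j a r))))
      ... | elsewhere r≢a r≢b = reflexive (≡.cong (λ k → M k s) (≡.sym (transpose-other a b r≢a r≢b)))

    -- Expand along the first row the matrix obtained from B by bordering it with the column x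
    -- and repeating row r on top; it has two equal rows.
    cramer : ∀ {m} (B : Matrix m) (x : Fin m → Carrier) (r : Fin m) →
             x r * Det B ≈ ∑ (λ q → B r q * Det (withColumn q x B))
    cramer {suc m} B x r = trans (+-inverseˡ-unique _ _ bordered-expansion) (-‿involutive _)
      where
      bordered : Fin (suc m) → Fin (suc (suc m)) → Carrier
      bordered r′ zero    = x r′
      bordered r′ (suc q) = B r′ q
      N : Matrix (suc (suc m))
      N zero     = bordered r
      N (suc r′) = bordered r′
      minor-suc : ∀ q r′ s → minor (suc q) N r′ s ≡ withColumn q x B r′ (decode (q , identityCode) s)
      minor-suc q r′ zero    = ≡.sym (withColumn-at q x B r′)
      minor-suc q r′ (suc s) = ≡.sym (≡.trans (≡.cong (withColumn q x B r′ ∘ punchIn q) (decode-identityCode s))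
                                              (withColumn-elsewhere x B r′ (punchInᵢ≢i q s)))
      det-minor-suc : ∀ q → Det (minor (suc q) N) ≈ sign (toℕ q) * Det (withColumn q x B)
      det-minor-suc q = begin
        Det (minor (suc q) N)                                            ≈⟨ det-cong≡ (minor-suc q) ⟩
        Det (λ r′ s → withColumn q x B r′ (decode (q , identityCode) s)) ≈⟨ det-decode-columns (q , identityCode) _ ⟩
        sign (toℕ q ℕ.+ inversions (identityCode {m})) * Det (withColumn q x B)
          ≡⟨ ≡.cong (λ k → sign k * Det (withColumn q x B))
                    (≡.trans (≡.cong (toℕ q ℕ.+_) (inversions-identityCode {m})) (ℕ.+-identityʳ _)) ⟩
        sign (toℕ q) * Det (withColumn q x B)                       ∎
      cofactorTerm-suc : ∀ q → cofactorTerm N (suc q) ≈ - (B r q * Det (withColumn q x B))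
      cofactorTerm-suc q = begin
        - sign (toℕ q) * (B r q * Det (minor (suc q) N))                     ≈⟨ *-congˡ (*-congˡ (det-minor-suc q)) ⟩
        - sign (toℕ q) * (B r q * (sign (toℕ q) * Det (withColumn q x B)))   ≈⟨ -‿distribˡ-* _ _ ⟨
        - (sign (toℕ q) * (B r q * (sign (toℕ q) * Det (withColumn q x B)))) ≈⟨ -‿cong (x∙yz≈y∙xz _ _ _) ⟩
        - (B r q * (sign (toℕ q) * (sign (toℕ q) * Det (withColumn q x B))))
          ≈⟨ -‿cong (*-congˡ (trans (sym (*-assoc _ _ _)) (trans (*-congʳ (sign-square (toℕ q))) (*-identityˡ _)))) ⟩
        - (B r q * Det (withColumn q x B))                            ∎
      bordered-expansion : x r * Det B + - ∑ (λ q → B r q * Det (withColumn q x B)) ≈ 0#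
      bordered-expansion = begin
        x r * Det B + - ∑ (λ q → B r q * Det (withColumn q x B))
          ≈⟨ +-cong (sym (*-identityˡ _)) (-‿distrib-∑ _) ⟩
        cofactorTerm N zero + ∑ (λ q → - (B r q * Det (withColumn q x B)))
          ≈⟨ +-congˡ (∑-cong cofactorTerm-suc) ⟨
        cofactorTerm N zero + ∑ (cofactorTerm N ∘ suc) ≈⟨ ∑-suc _ ⟨
        ∑ (cofactorTerm N)                             ≈⟨ laplace N ⟨
        Det N                                          ≈⟨ det-equal-rows {a = zero} {suc r} (λ ()) N (λ s → refl) ⟩
        0#                                             ∎

    plücker : ∀ {m} (A B : Matrix m) (p : Fin m) →
              Det A * Det B ≈ ∑ (λ q → Det (withColumn p (λ r → B r q) A) * Det (withColumn q (λ r → A r p) B))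
    plücker A B p = begin
      Det A * Det B                            ≈⟨ *-comm _ _ ⟩
      Det B * Det A                            ≈⟨ *-congˡ (det-cong≡ (withColumn-self p A)) ⟨
      Det B * Det (withColumn p a A)           ≈⟨ det-withColumn-* p (Det B) a A ⟨
      Det (withColumn p (λ r → Det B * a r) A) ≈⟨ det-withColumn-cong p A (λ r → trans (*-comm _ _) (cramer B a r)) ⟩
      Det (withColumn p (λ r → ∑ (λ q → B r q * Det (withColumn q a B))) A)
        ≈⟨ det-withColumn-cong p A (λ r → ∑-cong (λ q → *-comm _ _)) ⟩
      Det (withColumn p (λ r → ∑ (λ q → Det (withColumn q a B) * B r q)) A)
        ≈⟨ det-withColumn-∑ p (λ q → Det (withColumn q a B)) (λ q r → B r q) A ⟩
      ∑ (λ q → Det (withColumn q a B) * Det (withColumn p (λ r → B r q) A)) ≈⟨ ∑-cong (λ q → *-comm _ _) ⟩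
      ∑ (λ q → Det (withColumn p (λ r → B r q) A) * Det (withColumn q a B)) ∎
      where
      a = λ r → A r p

module Fillings where
  open import Data.Nat as ℕ using (ℕ; zero; suc; _≤_; s≤s)
  import Data.Nat.Properties as ℕ
  open import Data.Fin as Fin using (Fin; zero; suc)
  open import Data.Fin.Properties using (_≟_)
  open import Data.Fin.Subset using (Subset; _∈_; ⋃; ∣_∣)
  open import Data.Fin.Subset.Properties using (_∈?_; ∉⊥; x∈p∪q⁻; x∈p∪q⁺; ∣⁅x⁆∣≡1; p⊆q⇒∣p∣≤∣q∣; x∈⁅y⁆⇒x≡y;
    x∈p∧x≢y⇒x∈p-y; x∈p⇒∣p-x∣<∣p∣; nonempty?; ∣⊥∣≡0; Empty-unique; ⊆-reflexive)
  open import Data.Fin.Permutation as Perm using (Permutation′; _⟨$⟩ʳ_; _⟨$⟩ˡ_)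
  open import Data.Bool using (Bool; true; false)
  open import Data.Vec as Vec using ([]; _∷_)
  open import Data.Vec.Properties using (lookup∘tabulate; lookup⇒[]=; []=⇒lookup)
  open import Data.Vec.Functional using (toList)
  open import Data.List as List using (List; []; _∷_; allFin; filter; concatMap; length; lookup)
  open import Data.List.Properties using (tabulate-lookup; length-tabulate; map-tabulate; length-map)
  open import Data.List.Membership.Propositional renaming (_∈_ to _∈ₗ_)
  open import Data.List.Membership.Propositional.Properties using (∈-lookup; ∈-tabulate⁺; ∈-tabulate⁻; ∈-filter⁺; ∈-filter⁻;
    ∈-allFin; ∈-concatMap⁻; ∈-concat⁺′; ∈-map⁺)
  open import Data.List.Membership.Propositional.Properties.WithK using (unique∧set⇒bag)
  open import Data.List.Relation.Unary.Any as Any using (Any; here; there)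
  open import Data.List.Relation.Unary.Any.Properties using (map⁻)
  import Data.List.Relation.Unary.All as All
  import Data.List.Relation.Unary.All.Properties as All
  open import Data.List.Relation.Unary.AllPairs using (_∷_)
  import Data.List.Relation.Unary.AllPairs.Properties as AllPairs
  open import Data.List.Relation.Unary.Unique.Propositional using (Unique)
  import Data.List.Relation.Unary.Unique.Propositional.Properties as Unique
  open import Data.List.Relation.Binary.Permutation.Propositional using (_↭_)
  open import Data.List.Relation.Binary.Permutation.Propositional.Properties using (↭-length)
  open import Data.List.Relation.Binary.BagAndSetEquality using (∼bag⇒↭)
  open import Data.Product using (∃-syntax; _×_; _,_; proj₁; proj₂)
  open import Data.Sum using (inj₁; inj₂)
  open import Data.Empty using (⊥-elim)
  open import Function using (_∘_; id)
  open import Function.Bundles using (mk⇔)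
  open import Relation.Nullary using (yes; no; does)
  open import Relation.Nullary.Decidable using (_×-dec_; dec-true)
  open import Relation.Unary using (Pred; Decidable)
  open import Relation.Binary.PropositionalEquality as ≡ using (_≡_; _≢_)
  open import Defs using (IsFilling; Tableau; IsCorrelated; elems; IsAssociated; HasMultipleEdge)

  module _ {a} {A : Set a} where

    lookupOfLength : ∀ {n} (xs : List A) → length xs ≡ n → Fin n → A
    lookupOfLength xs ≡.refl = lookup xs

    toList-lookupOfLength : ∀ {n} (xs : List A) (len : length xs ≡ n) → toList (lookupOfLength xs len) ≡ xs
    toList-lookupOfLength xs ≡.refl = tabulate-lookup xs

    lookupOfLength-∈ : ∀ {n} (xs : List A) (len : length xs ≡ n) c → lookupOfLength xs len c ∈ₗ xs
    lookupOfLength-∈ xs ≡.refl = ∈-lookup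

    lookup-injective : ∀ (xs : List A) → Unique xs → ∀ {i j} → lookup xs i ≡ lookup xs j → i ≡ j
    lookup-injective (x ∷ xs) _            {zero}  {zero}  _ = ≡.refl
    lookup-injective (x ∷ xs) (x∉ ∷ _) {zero}  {suc j} e = ⊥-elim (All.lookup x∉ (∈-lookup j) e)
    lookup-injective (x ∷ xs) (x∉ ∷ _) {suc i} {zero}  e = ⊥-elim (All.lookup x∉ (∈-lookup i) (≡.sym e))
    lookup-injective (x ∷ xs) (_ ∷ u)  {suc i} {suc j} e = ≡.cong suc (lookup-injective xs u e)

    lookupOfLength-injective : ∀ {n} (xs : List A) (len : length xs ≡ n) → Unique xs →
                               ∀ {c c′} → lookupOfLength xs len c ≡ lookupOfLength xs len c′ → c ≡ c′
    lookupOfLength-injective xs ≡.refl = lookup-injective xs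

    length-enumeration : ∀ {n} (xs : List A) (f : Fin n → A) → Unique xs → (∀ {i j} → f i ≡ f j → i ≡ j) →
                         (∀ {x} → x ∈ₗ xs → ∃[ c ] f c ≡ x) → (∀ c → f c ∈ₗ xs) → length xs ≡ n
    length-enumeration xs f xs-unique f-injective xs⊆f f⊆xs =
      ≡.trans (↭-length xs↭f) (length-tabulate f)
      where
      to : ∀ {x} → x ∈ₗ xs → x ∈ₗ toList f
      to x∈ with xs⊆f x∈
      ... | c , ≡.refl = ∈-tabulate⁺ c
      from : ∀ {x} → x ∈ₗ toList f → x ∈ₗ xs
      from x∈ with ∈-tabulate⁻ x∈
      ... | c , ≡.refl = f⊆xs c
      xs↭f : xs ↭ toList f
      xs↭f = ∼bag⇒↭ (unique∧set⇒bag xs-unique (Unique.tabulate⁺ f-injective) (mk⇔ to from))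

  subsetOf : ∀ {m p} {P : Pred (Fin m) p} → Decidable P → Subset m
  subsetOf P? = Vec.tabulate (does ∘ P?)

  module _ {m p} {P : Pred (Fin m) p} (P? : Decidable P) where

    ∈-subsetOf⁺ : ∀ {k} → P k → k ∈ subsetOf P?
    ∈-subsetOf⁺ {k} Pk = lookup⇒[]= k _ (≡.trans (lookup∘tabulate _ k) (dec-true (P? k) Pk))

    ∈-subsetOf⁻ : ∀ {k} → k ∈ subsetOf P? → P k
    ∈-subsetOf⁻ {k} k∈ with P? k | ≡.trans (≡.sym (lookup∘tabulate (does ∘ P?) k)) ([]=⇒lookup k∈)
    ... | yes Pk | _ = Pk

  elems-unique : ∀ {m} (p : Subset m) → Unique (elems p)
  elems-unique {m} p = Unique.filter⁺ (_∈? p) (Unique.allFin⁺ m)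

  ∈-elems⁺ : ∀ {m} {p : Subset m} {k} → k ∈ p → k ∈ₗ elems p
  ∈-elems⁺ {p = p} {k} k∈p = ∈-filter⁺ (_∈? p) (∈-allFin k) k∈p

  ∈-elems⁻ : ∀ {m} {p : Subset m} {k} → k ∈ₗ elems p → k ∈ p
  ∈-elems⁻ {m} {p} k∈ = proj₂ (∈-filter⁻ (_∈? p) {xs = allFin m} k∈)

  private
    filter-map-suc : ∀ {m} (b : Bool) (p : Subset m) xs →
                     filter (_∈? (b ∷ p)) (List.map suc xs) ≡ List.map suc (filter (_∈? p) xs)
    filter-map-suc b p []       = ≡.refl
    filter-map-suc b p (x ∷ xs) with x ∈? p
    ... | yes _ = ≡.cong (suc x ∷_) (filter-map-suc b p xs)
    ... | no _  = filter-map-suc b p xs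

    length-elems-tail : ∀ {m} (b : Bool) (p : Subset m) →
                        length (filter (_∈? (b ∷ p)) (List.map suc (allFin m))) ≡ length (elems p)
    length-elems-tail {m} b p = ≡.trans (≡.cong length (filter-map-suc b p (allFin m))) (length-map Fin.suc (elems p))

  ∣p∣≡length-elems : ∀ {m} (p : Subset m) → ∣ p ∣ ≡ length (elems p)
  ∣p∣≡length-elems {zero}  []          = ≡.refl
  ∣p∣≡length-elems {suc m} (true ∷ p)  = ≡.cong suc (≡.trans (∣p∣≡length-elems p) (≡.sym (≡.trans
    (≡.cong (length ∘ filter (_∈? (true ∷ p))) (≡.sym (map-tabulate id suc))) (length-elems-tail true p))))
  ∣p∣≡length-elems {suc m} (false ∷ p) = ≡.trans (∣p∣≡length-elems p) (≡.sym (≡.trans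
    (≡.cong (length ∘ filter (_∈? (false ∷ p))) (≡.sym (map-tabulate id suc))) (length-elems-tail false p)))

  ∈-⋃⁺ : ∀ {m} (ps : List (Subset m)) {k p} → p ∈ₗ ps → k ∈ p → k ∈ ⋃ ps
  ∈-⋃⁺ (p ∷ ps) (here ≡.refl) k∈p = x∈p∪q⁺ (inj₁ k∈p)
  ∈-⋃⁺ (p ∷ ps) (there p∈ps)  k∈p = x∈p∪q⁺ (inj₂ (∈-⋃⁺ ps p∈ps k∈p))

  ∈-⋃⁻ : ∀ {m} (ps : List (Subset m)) {k} → k ∈ ⋃ ps → Any (k ∈_) ps
  ∈-⋃⁻ []       k∈ = ⊥-elim (∉⊥ k∈)
  ∈-⋃⁻ (p ∷ ps) k∈ with x∈p∪q⁻ p (⋃ ps) k∈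
  ... | inj₁ k∈p = here k∈p
  ... | inj₂ k∈⋃ = there (∈-⋃⁻ ps k∈⋃)

  ∈⇒1≤∣p∣ : ∀ {m} {k : Fin m} {p : Subset m} → k ∈ p → 1 ≤ ∣ p ∣
  ∈⇒1≤∣p∣ {k = k} {p} k∈p = ≡.subst (_≤ ∣ p ∣) (∣⁅x⁆∣≡1 k)
    (p⊆q⇒∣p∣≤∣q∣ (λ x∈⁅k⁆ → ≡.subst (_∈ p) (≡.sym (x∈⁅y⁆⇒x≡y k x∈⁅k⁆)) k∈p))

  ∈₂⇒2≤∣p∣ : ∀ {m} {k l : Fin m} {p : Subset m} → k ≢ l → k ∈ p → l ∈ p → 2 ≤ ∣ p ∣
  ∈₂⇒2≤∣p∣ k≢l k∈p l∈p = ℕ.≤-trans (s≤s (∈⇒1≤∣p∣ (x∈p∧x≢y⇒x∈p-y l∈p (k≢l ∘ ≡.sym)))) (x∈p⇒∣p-x∣<∣p∣ k∈p)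

  1≤∣p∣⇒∈ : ∀ {m} (p : Subset m) → 1 ≤ ∣ p ∣ → ∃[ k ] k ∈ p
  1≤∣p∣⇒∈ {m} p 1≤∣p∣ with nonempty? p
  ... | yes nonempty = nonempty
  ... | no empty     = ⊥-elim (ℕ.<-irrefl ≡.refl (ℕ.≤-trans 1≤∣p∣
                         (≡.subst (∣ p ∣ ≤_) (∣⊥∣≡0 m) (p⊆q⇒∣p∣≤∣q∣ (⊆-reflexive (Empty-unique empty))))))

  -- For the family C i (resp. λ i → C i j) of a tableau C, members is Defs.rowList C i (resp. colList C j).
  module DisjointFamily {d N} (F : Fin d → Subset N) (disjoint : ∀ {k x y} → k ∈ F x → k ∈ F y → x ≡ y) where

    members : List (Fin N)
    members = concatMap (elems ∘ F) (allFin d)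

    members-unique : Unique members
    members-unique = Unique.concat⁺ (All.map⁺ (All.tabulate⁺ (elems-unique ∘ F)))
      (AllPairs.map⁺ (AllPairs.tabulate⁺ {f = id} λ x≢y (k∈x , k∈y) → x≢y (disjoint (∈-elems⁻ k∈x) (∈-elems⁻ k∈y))))

    ∈-members⁺ : ∀ {k x} → k ∈ F x → k ∈ₗ members
    ∈-members⁺ {x = x} k∈ = ∈-concat⁺′ (∈-elems⁺ k∈) (∈-map⁺ (elems ∘ F) (∈-allFin x))

    ∈-members⁻ : ∀ {k} → k ∈ₗ members → ∃[ x ] k ∈ F x
    ∈-members⁻ k∈ with Any.satisfied (∈-concatMap⁻ (elems ∘ F) {xs = allFin d} k∈)
    ... | x , k∈x = x , ∈-elems⁻ k∈x

    union : Subset N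
    union = ⋃ (List.map F (allFin d))

    ∈-union⁺ : ∀ {k x} → k ∈ F x → k ∈ union
    ∈-union⁺ {x = x} = ∈-⋃⁺ (List.map F (allFin d)) (∈-map⁺ F (∈-allFin x))

    ∈-union⁻ : ∀ {k} → k ∈ union → ∃[ x ] k ∈ F x
    ∈-union⁻ k∈ = Any.satisfied (map⁻ (∈-⋃⁻ (List.map F (allFin d)) k∈))

    module Enumerated {n} (f : Fin n → Fin N) (f-injective : ∀ {c c′} → f c ≡ f c′ → c ≡ c′)
                      (covered : ∀ c → ∃[ x ] f c ∈ F x) (onto : ∀ {k x} → k ∈ F x → ∃[ c ] f c ≡ k) where

      length-members : length members ≡ n
      length-members = length-enumeration members f members-unique f-injective
        (onto ∘ proj₂ ∘ ∈-members⁻) (λ c → ∈-members⁺ (proj₂ (covered c)))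

      ∣union∣ : ∣ union ∣ ≡ n
      ∣union∣ = ≡.trans (∣p∣≡length-elems union) (length-enumeration (elems union) f (elems-unique union) f-injective
        (onto ∘ proj₂ ∘ ∈-union⁻ ∘ ∈-elems⁻) (λ c → ∈-elems⁺ (∈-union⁺ (proj₂ (covered c)))))

      enumeration : Fin n → Fin N
      enumeration = lookupOfLength members length-members

      toList-enumeration : toList enumeration ≡ members
      toList-enumeration = toList-lookupOfLength members length-members

      reindex : Fin n → Fin n
      reindex c = proj₁ (onto (proj₂ (∈-members⁻ (lookupOfLength-∈ members length-members c))))

      enumeration≡f∘reindex : ∀ c → enumeration c ≡ f (reindex c)
      enumeration≡f∘reindex c = ≡.sym (proj₂ (onto (proj₂ (∈-members⁻ (lookupOfLength-∈ members length-members c)))))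

      reindex-injective : ∀ {c c′} → reindex c ≡ reindex c′ → c ≡ c′
      reindex-injective {c} {c′} e = lookupOfLength-injective members length-members members-unique
        (≡.trans (enumeration≡f∘reindex c) (≡.trans (≡.cong f e) (≡.sym (enumeration≡f∘reindex c′))))

  Array : ℕ → ℕ → Set
  Array d n = Fin d → Fin n → Fin (d ℕ.* n)

  module Filling {d n} {S : Array d n} (S-filling : IsFilling d n S) where

    row : Fin (d ℕ.* n) → Fin d
    row k = proj₁ (proj₁ S-filling k)

    column : Fin (d ℕ.* n) → Fin n
    column k = proj₁ (proj₂ (proj₁ S-filling k))

    at-position : ∀ k → S (row k) (column k) ≡ k
    at-position k = proj₂ (proj₂ (proj₁ S-filling k))

    position-unique : ∀ {i c k} → S i c ≡ k → row k ≡ i × column k ≡ c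
    position-unique {k = k} e = proj₂ S-filling (row k) (column k) _ _ (≡.trans (at-position k) (≡.sym e))

    injective : ∀ {i c i′ c′} → S i c ≡ S i′ c′ → i ≡ i′ × c ≡ c′
    injective = proj₂ S-filling _ _ _ _

    at-row : ∀ {i k} → row k ≡ i → S i (column k) ≡ k
    at-row ≡.refl = at-position _

  relabel : ∀ {d n} → Permutation′ (d ℕ.* n) → Array d n → Array d n
  relabel σ S i c = σ ⟨$⟩ʳ S i c

  relabel-filling : ∀ {d n} (σ : Permutation′ (d ℕ.* n)) {S : Array d n} → IsFilling d n S → IsFilling d n (relabel σ S)
  relabel-filling σ (onto , injective) =
    (λ k → let (i , c , e) = onto (σ ⟨$⟩ˡ k) in i , c , ≡.trans (≡.cong (σ ⟨$⟩ʳ_) e) (Perm.inverseʳ σ))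
    , (λ i c i′ c′ e → injective i c i′ c′ (≡.trans (≡.sym (Perm.inverseˡ σ)) (≡.trans (≡.cong (σ ⟨$⟩ˡ_) e) (Perm.inverseˡ σ))))

  module TableauOf {d n} {S T : Array d n} (S-filling : IsFilling d n S) (T-filling : IsFilling d n T) where

    module S = Filling S-filling
    module T = Filling T-filling

    C : Tableau d n
    C i j = subsetOf (λ k → S.row k ≟ i ×-dec T.row k ≟ j)

    ∈-C⁺ : ∀ {k i j} → S.row k ≡ i → T.row k ≡ j → k ∈ C i j
    ∈-C⁺ {i = i} {j} eS eT = ∈-subsetOf⁺ (λ k → S.row k ≟ i ×-dec T.row k ≟ j) (eS , eT)

    ∈-C⁻ : ∀ {k i j} → k ∈ C i j → S.row k ≡ i × T.row k ≡ j
    ∈-C⁻ {i = i} {j} = ∈-subsetOf⁻ (λ k → S.row k ≟ i ×-dec T.row k ≟ j)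

    module Row (i : Fin d) = DisjointFamily (C i) (λ k∈x k∈y → ≡.trans (≡.sym (proj₂ (∈-C⁻ k∈x))) (proj₂ (∈-C⁻ k∈y)))
    module Column (j : Fin d) = DisjointFamily (λ i → C i j) (λ k∈x k∈y → ≡.trans (≡.sym (proj₁ (∈-C⁻ k∈x))) (proj₁ (∈-C⁻ k∈y)))

    module RowOrder (i : Fin d) = Row.Enumerated i (S i)
      (λ e → proj₂ (S.injective e)) (λ c → T.row (S i c) , ∈-C⁺ (proj₁ (S.position-unique ≡.refl)) ≡.refl)
      (λ k∈ → S.column _ , S.at-row (proj₁ (∈-C⁻ k∈)))
    module ColumnOrder (j : Fin d) = Column.Enumerated j (T j)
      (λ e → proj₂ (T.injective e)) (λ c → S.row (T j c) , ∈-C⁺ ≡.refl (proj₁ (T.position-unique ≡.refl)))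
      (λ k∈ → T.column _ , T.at-row (proj₂ (∈-C⁻ k∈)))

    correlated : IsCorrelated d n C
    correlated = (λ k → S.row k , T.row k , ∈-C⁺ ≡.refl ≡.refl)
               , (λ k i j i′ j′ k∈ k∈′ → ≡.trans (≡.sym (proj₁ (∈-C⁻ k∈))) (proj₁ (∈-C⁻ k∈′))
                                       , ≡.trans (≡.sym (proj₂ (∈-C⁻ k∈))) (proj₂ (∈-C⁻ k∈′)))
               , RowOrder.∣union∣
               , ColumnOrder.∣union∣

    S′ T′ : Array d n
    S′ i = RowOrder.enumeration i
    T′ j = ColumnOrder.enumeration j

    associated : IsAssociated C S′ T′
    associated = RowOrder.toList-enumeration , ColumnOrder.toList-enumeration

    multipleEdge : ∀ {X Y} → X ≢ Y → S.row X ≡ S.row Y → T.row X ≡ T.row Y → HasMultipleEdge C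
    multipleEdge {X} X≢Y same-S-row same-T-row =
      S.row X , T.row X , ∈₂⇒2≤∣p∣ X≢Y (∈-C⁺ ≡.refl ≡.refl) (∈-C⁺ (≡.sym same-S-row) (≡.sym same-T-row))

module Connectivity where
  open import Data.Nat as ℕ using (ℕ; zero; suc; _≤_; s≤s)
  import Data.Nat.Properties as ℕ
  open import Data.Fin using (Fin; zero; suc)
  open import Data.Fin.Properties using (any?)
  open import Data.Fin.Subset using (Subset; _∈_; _⊆_; _∪_; ⁅_⁆; ∣_∣)
  open import Data.Fin.Subset.Properties using (_∈?_; _⊆?_; x∈p∪q⁻; x∈p∪q⁺; x∈⁅x⁆; x∈⁅y⁆⇒x≡y; ∣⁅x⁆∣≡1; p⊂q⇒∣p∣<∣q∣; ∣p∣≤n)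
  open import Data.Product using (∃-syntax; _×_; _,_; proj₁; proj₂)
  open import Data.Sum using (_⊎_; inj₁; inj₂)
  open import Data.Empty using (⊥-elim)
  open import Relation.Nullary using (¬_; Dec; yes; no)
  open import Relation.Nullary.Decidable using (_×-dec_; ¬?; decidable-stable)
  open import Relation.Binary.Construct.Closure.ReflexiveTransitive using (Star; ε; _◅_; _◅◅_; reverse)
  open import Relation.Binary.PropositionalEquality as ≡ using (_≡_)
  open import Defs using (IsFilling; Adj; GraphConnected; Vertex)
  open Fillings

  -- Breadth-first search: reached k is the set of vertices at distance at most k from x.
  module Reachability {d} (E : Fin d → Fin d → Set) (E? : ∀ a b → Dec (E a b)) (x : Fin d) where

    neighbours : Subset d → Subset d
    neighbours p = subsetOf (λ y → any? (λ z → z ∈? p ×-dec E? z y))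

    reached : ℕ → Subset d
    reached zero    = ⁅ x ⁆
    reached (suc k) = reached k ∪ neighbours (reached k)

    reached-sound : ∀ k {y} → y ∈ reached k → Star E x y
    reached-sound zero y∈ with x∈⁅y⁆⇒x≡y x y∈
    ... | ≡.refl = ε
    reached-sound (suc k) y∈ with x∈p∪q⁻ (reached k) _ y∈
    ... | inj₁ y∈reached = reached-sound k y∈reached
    ... | inj₂ y∈next with ∈-subsetOf⁻ (λ y → any? (λ z → z ∈? reached k ×-dec E? z y)) y∈next
    ...   | z , z∈ , z→y = reached-sound k z∈ ◅◅ (z→y ◅ ε)

    reached-mono : ∀ k → reached k ⊆ reached (suc k)
    reached-mono k y∈ = x∈p∪q⁺ (inj₁ y∈)

    x∈reached : ∀ k → x ∈ reached k
    x∈reached zero    = x∈⁅x⁆ x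
    x∈reached (suc k) = reached-mono k (x∈reached k)

    closed⇒complete : ∀ k → reached (suc k) ⊆ reached k → ∀ {z y} → z ∈ reached k → Star E z y → y ∈ reached k
    closed⇒complete k closed z∈ ε           = z∈
    closed⇒complete k closed z∈ (z→w ◅ w→y) = closed⇒complete k closed (closed (x∈p∪q⁺ (inj₂
      (∈-subsetOf⁺ (λ y → any? (λ z → z ∈? reached k ×-dec E? z y)) (_ , z∈ , z→w))))) w→y

    growing : ∀ k → (∃[ k′ ] reached (suc k′) ⊆ reached k′) ⊎ suc k ≤ ∣ reached k ∣
    growing zero = inj₂ (ℕ.≤-reflexive (≡.sym (∣⁅x⁆∣≡1 x)))
    growing (suc k) with growing k
    ... | inj₁ closed = inj₁ closed
    ... | inj₂ k<∣reached∣ with reached (suc k) ⊆? reached k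
    ...   | yes closed = inj₁ (k , closed)
    ...   | no ¬closed with any? (λ z → z ∈? reached (suc k) ×-dec ¬? (z ∈? reached k))
    ...     | yes (z , z∈new , z∉old) = inj₂ (ℕ.≤-trans (s≤s k<∣reached∣) (p⊂q⇒∣p∣<∣q∣ (reached-mono k , z , z∈new , z∉old)))
    ...     | no none = ⊥-elim (¬closed λ {z} z∈new → decidable-stable (z ∈? reached k) (λ z∉old → none (z , z∈new , z∉old)))

    eventually-closed : ∃[ k ] reached (suc k) ⊆ reached k
    eventually-closed with growing d
    ... | inj₁ closed = closed
    ... | inj₂ d<∣reached∣ = ⊥-elim (ℕ.<-irrefl ≡.refl (ℕ.≤-trans d<∣reached∣ (∣p∣≤n (reached d))))

    reachable? : (∀ y → Star E x y) ⊎ (∃[ y ] ¬ Star E x y)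
    reachable? with eventually-closed
    ... | k , closed with any? (λ y → ¬? (y ∈? reached k))
    ...   | yes (y , y∉) = inj₂ (y , λ x→y → y∉ (closed⇒complete k closed (x∈reached k) x→y))
    ...   | no all∈      = inj₁ (λ y → reached-sound k (decidable-stable (y ∈? reached k) (λ y∉ → all∈ (y , y∉))))

  module TableauGraph {d n} {S T : Array d n} (S-filling : IsFilling d n S) (T-filling : IsFilling d n T) where
    open TableauOf S-filling T-filling

    Linked : Fin (d ℕ.* n) → Fin (d ℕ.* n) → Set
    Linked k l = S.row k ≡ S.row l ⊎ T.row k ≡ T.row l

    ShareColumn : Fin d → Fin d → Set
    ShareColumn a b = ∃[ j ] 1 ≤ ∣ C a j ∣ × 1 ≤ ∣ C b j ∣

    shareColumn? : ∀ a b → Dec (ShareColumn a b)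
    shareColumn? a b = any? (λ j → 1 ℕ.≤? ∣ C a j ∣ ×-dec 1 ℕ.≤? ∣ C b j ∣)

    shareColumn-sym : ∀ {a b} → ShareColumn a b → ShareColumn b a
    shareColumn-sym (j , a∼j , b∼j) = j , b∼j , a∼j

    linked-path : ∀ {a b} → Star ShareColumn a b → ∀ {k l} → S.row k ≡ a → S.row l ≡ b → Star Linked k l
    linked-path ε                      k∈a l∈b = inj₁ (≡.trans k∈a (≡.sym l∈b)) ◅ ε
    linked-path ((j , a∼j , c∼j) ◅ c→b) k∈a l∈b with 1≤∣p∣⇒∈ _ a∼j | 1≤∣p∣⇒∈ _ c∼j
    ... | k′ , k′∈ | l′ , l′∈ = inj₁ (≡.trans k∈a (≡.sym (proj₁ (∈-C⁻ k′∈))))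
                              ◅ inj₂ (≡.trans (proj₂ (∈-C⁻ k′∈)) (≡.sym (proj₂ (∈-C⁻ l′∈))))
                              ◅ linked-path c→b (proj₁ (∈-C⁻ l′∈)) l∈b

    -- What a path of the bipartite graph of C starting at the left vertex a reveals about its endpoint.
    ReachableFrom : Fin d → Vertex d → Set
    ReachableFrom a (inj₁ b) = Star ShareColumn a b
    ReachableFrom a (inj₂ j) = ∃[ b ] Star ShareColumn a b × 1 ≤ ∣ C b j ∣

    reachableFrom-step : ∀ {a u v} → Star (Adj C) u v → ReachableFrom a u → ReachableFrom a v
    reachableFrom-step ε r = r
    reachableFrom-step {u = inj₁ b} (_◅_ {j = inj₂ j} b∼j j→v) a→b = reachableFrom-step j→v (b , a→b , b∼j)
    reachableFrom-step {u = inj₂ j} (_◅_ {j = inj₁ c} c∼j c→v) (b , a→b , b∼j) =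
      reachableFrom-step c→v (a→b ◅◅ ((j , b∼j , c∼j) ◅ ε))
    reachableFrom-step {u = inj₁ b} (_◅_ {j = inj₁ _} () _) _
    reachableFrom-step {u = inj₂ j} (_◅_ {j = inj₂ _} () _) _

    linked-or-disconnected : Fin d → (∀ k l → Star Linked k l) ⊎ ¬ GraphConnected C
    linked-or-disconnected a with Reachability.reachable? ShareColumn shareColumn? a
    ... | inj₁ all = inj₁ λ k l → linked-path (reverse shareColumn-sym (all (S.row k)) ◅◅ all (S.row l)) ≡.refl ≡.refl
    ... | inj₂ (b , ¬a→b) = inj₂ λ connected → ¬a→b (reachableFrom-step (connected (inj₁ a) (inj₁ b)) ε)

module Span {c ℓ : Level} (R : CommutativeRing c ℓ) (d n : ℕ) where
  open import Data.Nat as ℕ using (ℕ; zero; suc)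
  open import Data.Fin using (Fin; zero; suc)
  open import Data.List using (List; []; _∷_; _++_; map)
  open import Data.Product using (Σ-syntax; _×_; _,_; proj₁)
  open import Data.Unit using (tt)
  open import Function using (_∘_)
  open import Relation.Binary.PropositionalEquality as ≡ using (_≡_)
  open import Defs using (IsFilling; InM; MTerm; φ; φComb)
  open LehmerCodes
  open Fillings
  import Relation.Binary.Reasoning.Setoid

  open CommutativeRing R hiding (zero)
  open BigOperators R
  open Determinant R
  open Relation.Binary.Reasoning.Setoid setoid

  Vectors : Set c
  Vectors = Fin (d ℕ.* n) → Fin n → Carrier

  Form : Set c
  Form = Vectors → Vectors → Carrier

  detProduct : Array d n → Vectors → Carrier
  detProduct S v = ∏ (λ i → Det (λ r s → v (S i s) r))

  φ≈detProduct : ∀ (S T : Array d n) v w → φ R S T v w ≈ detProduct S v * detProduct T w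
  φ≈detProduct S T v w = *-cong (product-of-dets S v) (product-of-dets T w)
    where
    product-of-dets : ∀ (S : Array d n) v → Defs.prodR R (λ i → Defs.det R (λ r s → v (S i s) r)) ≈ detProduct S v
    product-of-dets S v = trans (reflexive (prodR≡∏ _)) (∏-cong (λ i → reflexive (det≡Det _)))

  φ-cong≡ : ∀ {S S′ T T′ : Array d n} → (∀ i s → S i s ≡ S′ i s) → (∀ j s → T j s ≡ T′ j s) →
                   ∀ v w → φ R S T v w ≈ φ R S′ T′ v w
  φ-cong≡ {S} {S′} {T} {T′} S≗S′ T≗T′ v w = begin
    φ R S T v w                     ≈⟨ φ≈detProduct S T v w ⟩
    detProduct S v * detProduct T w ≈⟨ *-cong (∏-cong (λ i → det-cong≡ (λ r s → ≡.cong (λ k → v k r) (S≗S′ i s))))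
                                                          (∏-cong (λ j → det-cong≡ (λ r s → ≡.cong (λ k → w k r) (T≗T′ j s)))) ⟩
    detProduct S′ v * detProduct T′ w ≈⟨ φ≈detProduct S′ T′ v w ⟨
    φ R S′ T′ v w                     ∎

  φ𝔐 : List (MTerm R d n) → Form
  φ𝔐 = φComb R

  Inφ𝔐 : Form → Set (c ⊔ ℓ)
  Inφ𝔐 h = Σ[ ts ∈ List (MTerm R d n) ] (∀ v w → h v w ≈ φ𝔐 ts v w)

  φ𝔐-++ : ∀ ts us v w → φ𝔐 (ts ++ us) v w ≈ φ𝔐 ts v w + φ𝔐 us v w
  φ𝔐-++ []       us v w = sym (+-identityˡ _)
  φ𝔐-++ (t ∷ ts) us v w = trans (+-congˡ (φ𝔐-++ ts us v w)) (sym (+-assoc _ _ _))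

  scaleTerm : Carrier → MTerm R d n → MTerm R d n
  scaleTerm a t = record t { coeff = a * MTerm.coeff t }

  φ𝔐-scale : ∀ a ts v w → φ𝔐 (map (scaleTerm a) ts) v w ≈ a * φ𝔐 ts v w
  φ𝔐-scale a []       v w = sym (zeroʳ a)
  φ𝔐-scale a (t ∷ ts) v w = trans (+-cong (*-assoc _ _ _) (φ𝔐-scale a ts v w)) (sym (distribˡ _ _ _))

  inφ𝔐-0 : Inφ𝔐 (λ _ _ → 0#)
  inφ𝔐-0 = [] , λ _ _ → refl

  inφ𝔐-+ : ∀ {g h} → Inφ𝔐 g → Inφ𝔐 h → Inφ𝔐 (λ v w → g v w + h v w)
  inφ𝔐-+ (ts , g≈) (us , h≈) = ts ++ us , λ v w → trans (+-cong (g≈ v w) (h≈ v w)) (sym (φ𝔐-++ ts us v w))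

  inφ𝔐-* : ∀ {h} a → Inφ𝔐 h → Inφ𝔐 (λ v w → a * h v w)
  inφ𝔐-* a (ts , h≈) = map (scaleTerm a) ts , λ v w → trans (*-congˡ (h≈ v w)) (sym (φ𝔐-scale a ts v w))

  inφ𝔐-cong : ∀ {g h} → (∀ v w → g v w ≈ h v w) → Inφ𝔐 h → Inφ𝔐 g
  inφ𝔐-cong g≈h (ts , h≈) = ts , λ v w → trans (g≈h v w) (h≈ v w)

  inφ𝔐-∑ : ∀ {k} (h : Fin k → Form) → (∀ q → Inφ𝔐 (h q)) → Inφ𝔐 (λ v w → ∑ (λ q → h q v w))
  inφ𝔐-∑ {zero}  h _  = inφ𝔐-cong (λ v w → ∑-empty _) inφ𝔐-0
  inφ𝔐-∑ {suc k} h in𝔐 = inφ𝔐-cong (λ v w → ∑-suc _) (inφ𝔐-+ (in𝔐 zero) (inφ𝔐-∑ (h ∘ suc) (in𝔐 ∘ suc)))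

  infix 4 _≃_·_mod𝔐

  _≃_·_mod𝔐 : Form → Carrier → Form → Set (c ⊔ ℓ)
  g ≃ a · h mod𝔐 = Σ[ r ∈ Form ] Inφ𝔐 r × (∀ v w → g v w ≈ a * h v w + r v w)

  ≃-refl : ∀ {h} → h ≃ 1# · h mod𝔐
  ≃-refl = (λ _ _ → 0#) , inφ𝔐-0 , λ v w → sym (trans (+-identityʳ _) (*-identityˡ _))

  ≃-trans : ∀ {f g h a b} → f ≃ a · g mod𝔐 → g ≃ b · h mod𝔐 → f ≃ a * b · h mod𝔐
  ≃-trans {f} {g} {h} {a} {b} (r , r∈ , f≈) (r′ , r′∈ , g≈) =
    (λ v w → a * r′ v w + r v w) , inφ𝔐-+ (inφ𝔐-* a r′∈) r∈ , λ v w → begin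
      f v w                                  ≈⟨ f≈ v w ⟩
      a * g v w + r v w                      ≈⟨ +-congʳ (*-congˡ (g≈ v w)) ⟩
      a * (b * h v w + r′ v w) + r v w       ≈⟨ +-congʳ (distribˡ _ _ _) ⟩
      (a * (b * h v w) + a * r′ v w) + r v w ≈⟨ +-assoc _ _ _ ⟩
      a * (b * h v w) + (a * r′ v w + r v w) ≈⟨ +-congʳ (*-assoc _ _ _) ⟨
      (a * b) * h v w + (a * r′ v w + r v w) ∎

  ≃-coeff : ∀ {g h a b} → a ≈ b → g ≃ a · h mod𝔐 → g ≃ b · h mod𝔐
  ≃-coeff a≈b (r , r∈ , g≈) = r , r∈ , λ v w → trans (g≈ v w) (+-congʳ (*-congʳ a≈b))

  ≃-congˡ : ∀ {f g h a} → (∀ v w → f v w ≈ g v w) → g ≃ a · h mod𝔐 → f ≃ a · h mod𝔐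
  ≃-congˡ f≈g (r , r∈ , g≈) = r , r∈ , λ v w → trans (f≈g v w) (g≈ v w)

  ≃-scale : ∀ {g h a} b → g ≃ a · h mod𝔐 → (λ v w → b * g v w) ≃ b * a · h mod𝔐
  ≃-scale {g} {h} {a} b (r , r∈ , g≈) = (λ v w → b * r v w) , inφ𝔐-* b r∈ , λ v w → begin
    b * g v w                   ≈⟨ *-congˡ (g≈ v w) ⟩
    b * (a * h v w + r v w)     ≈⟨ distribˡ _ _ _ ⟩
    b * (a * h v w) + b * r v w ≈⟨ +-congʳ (*-assoc _ _ _) ⟨
    (b * a) * h v w + b * r v w ∎

  ≃-∑ : ∀ {k} {g : Fin k → Form} {h a} → (∀ q → g q ≃ a q · h mod𝔐) → (λ v w → ∑ (λ q → g q v w)) ≃ ∑ a · h mod𝔐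
  ≃-∑ {zero} {g} {h} {a} _ = (λ _ _ → 0#) , inφ𝔐-0 , λ v w → begin
    ∑ (λ q → g q v w) ≈⟨ ∑-empty _ ⟩
    0#                ≈⟨ zeroˡ _ ⟨
    0# * h v w        ≈⟨ *-congʳ (∑-empty a) ⟨
    ∑ a * h v w       ≈⟨ +-identityʳ _ ⟨
    ∑ a * h v w + 0#  ∎
  ≃-∑ {suc k} {g} {h} {a} g≃ with g≃ zero | ≃-∑ {g = g ∘ suc} {h} {a ∘ suc} (g≃ ∘ suc)
  ... | r , r∈ , g₀≈ | r′ , r′∈ , g₊≈ = (λ v w → r v w + r′ v w) , inφ𝔐-+ r∈ r′∈ , λ v w → begin
    ∑ (λ q → g q v w)                                         ≈⟨ ∑-suc _ ⟩
    g zero v w + ∑ (λ q → g (suc q) v w)                      ≈⟨ +-cong (g₀≈ v w) (g₊≈ v w) ⟩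
    (a zero * h v w + r v w) + (∑ (a ∘ suc) * h v w + r′ v w) ≈⟨ +-interchange _ _ _ _ ⟩
    (a zero * h v w + ∑ (a ∘ suc) * h v w) + (r v w + r′ v w) ≈⟨ +-congʳ (distribʳ _ _ _) ⟨
    (a zero + ∑ (a ∘ suc)) * h v w + (r v w + r′ v w)         ≈⟨ +-congʳ (*-congʳ (∑-suc a)) ⟨
    ∑ a * h v w + (r v w + r′ v w)                            ∎

  ≃-∑Code : ∀ {m} {g : LehmerCode m → Form} {h : Form} {a : LehmerCode m → Carrier} → (∀ π → g π ≃ a π · h mod𝔐) →
            (λ v w → ∑Code (λ π → g π v w)) ≃ ∑Code a · h mod𝔐
  ≃-∑Code {zero}  g≃ = g≃ tt
  ≃-∑Code {suc m} g≃ = ≃-∑ (λ j → ≃-∑Code (λ π → g≃ (j , π)))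

  Reordering : Set
  Reordering = Σ[ ρ ∈ (Fin d → Fin n → Fin n) ] (∀ i {c c′} → ρ i c ≡ ρ i c′ → c ≡ c′)

  reorderingSign : Reordering → Carrier
  reorderingSign (ρ , ρ-injective) = ∏ (λ i → sign (inversions (encode (ρ i) (ρ-injective i))))

  reorderingSign² : ∀ ρ → reorderingSign ρ * reorderingSign ρ ≈ 1#
  reorderingSign² (ρ , ρ-injective) = trans (sym (∏-distrib-* _ _)) (∏-one (λ i → sign-square (inversions (encode (ρ i) (ρ-injective i)))))

  detProduct-reordered : ∀ {S S′ : Array d n} (ρ : Reordering) → (∀ i c → S′ i c ≡ S i (proj₁ ρ i c)) →
                         ∀ v → detProduct S′ v ≈ reorderingSign ρ * detProduct S v
  detProduct-reordered {S} {S′} (ρ , ρ-injective) S′≡S∘ρ v = trans (∏-cong reordered-row) (∏-distrib-* _ _)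
    where
    reordered-row : ∀ i → Det (λ r s → v (S′ i s) r) ≈ sign (inversions (encode (ρ i) (ρ-injective i))) * Det (λ r s → v (S i s) r)
    reordered-row i = begin
      Det (λ r s → v (S′ i s) r)
        ≈⟨ det-cong≡ (λ r s → ≡.cong (λ k → v k r) (≡.trans (S′≡S∘ρ i s) (≡.cong (S i) (≡.sym (decode-encode (ρ i) (ρ-injective i) s))))) ⟩
      Det (λ r s → v (S i (decode (encode (ρ i) (ρ-injective i)) s)) r)            ≈⟨ det-decode-columns _ (λ r s → v (S i s) r) ⟩
      sign (inversions (encode (ρ i) (ρ-injective i))) * Det (λ r s → v (S i s) r) ∎

  -- [S] ⊗ [T̄] is ± the element associated to its tableau: S′ and T′ only reorder the rows of S and T.
  inM⇒inφ𝔐 : ∀ {S T : Array d n} (S-filling : IsFilling d n S) (T-filling : IsFilling d n T) →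
              InM (TableauOf.C S-filling T-filling) → Inφ𝔐 (φ R S T)
  inM⇒inφ𝔐 {S} {T} S-filling T-filling C∈𝔐 = term ∷ [] , λ v w → sym (begin
    ε * φ R S′ T′ v w + 0#                  ≈⟨ +-identityʳ _ ⟩
    ε * φ R S′ T′ v w                       ≈⟨ *-congˡ (φ≈detProduct S′ T′ v w) ⟩
    ε * (detProduct S′ v * detProduct T′ w) ≈⟨ *-congˡ (*-cong (detProduct-reordered ρS RowOrder.enumeration≡f∘reindex v)
                                                                                (detProduct-reordered ρT ColumnOrder.enumeration≡f∘reindex w)) ⟩
    ε * ((εS * detProduct S v) * (εT * detProduct T w)) ≈⟨ *-congˡ (interchange _ _ _ _) ⟩
    ε * (ε * (detProduct S v * detProduct T w))         ≈⟨ *-assoc _ _ _ ⟨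
    (ε * ε) * (detProduct S v * detProduct T w)         ≈⟨ *-congʳ (trans (interchange _ _ _ _) (*-cong (reorderingSign² ρS) (reorderingSign² ρT))) ⟩
    (1# * 1#) * (detProduct S v * detProduct T w)       ≈⟨ trans (*-congʳ (*-identityˡ 1#)) (*-identityˡ _) ⟩
    detProduct S v * detProduct T w                     ≈⟨ φ≈detProduct S T v w ⟨
    φ R S T v w                                         ∎)
    where
    open TableauOf S-filling T-filling
    ρS ρT : Reordering
    ρS = RowOrder.reindex , RowOrder.reindex-injective
    ρT = ColumnOrder.reindex , ColumnOrder.reindex-injective
    εS = reorderingSign ρS
    εT = reorderingSign ρT
    ε = εS * εT
    term : MTerm R d n
    term = record { coeff = ε ; tableau = C ; correlated = correlated ; inM = C∈𝔐
                  ; arrS = S′ ; arrT = T′ ; associated = associated }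

  vanishing-≃⇒inφ𝔐 : ∀ {g h a b} → (∀ v w → g v w ≈ 0#) → g ≃ a · h mod𝔐 → b * a ≈ 1# → Inφ𝔐 h
  vanishing-≃⇒inφ𝔐 {g} {h} {a} {b} g≈0 (r , r∈φ𝔐 , g≈) b*a≈1 = inφ𝔐-cong h≈ (inφ𝔐-* (- b) r∈φ𝔐)
    where
    h≈ : ∀ v w → h v w ≈ - b * r v w
    h≈ v w = begin
      h v w           ≈⟨ *-identityˡ _ ⟨
      1# * h v w      ≈⟨ *-congʳ b*a≈1 ⟨
      (b * a) * h v w ≈⟨ *-assoc b a _ ⟩
      b * (a * h v w) ≈⟨ *-congˡ (+-inverseˡ-unique _ _ (trans (sym (g≈ v w)) (g≈0 v w))) ⟩
      b * - r v w     ≈⟨ -‿distribʳ-* b _ ⟨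
      - (b * r v w)   ≈⟨ -‿distribˡ-* b _ ⟩
      - b * r v w     ∎

module Exchange {c ℓ : Level} (R : CommutativeRing c ℓ) (d n : ℕ) (two⁻¹ : Determinant.TwoInvertible R) where
  open import Data.Nat as ℕ using (ℕ)
  open import Data.Fin using (Fin)
  open import Data.Fin.Properties using (_≟_)
  import Data.Fin.Permutation as Perm
  open import Data.Fin.Permutation.Components using (transpose)
  open import Data.Product using (_,_; proj₁; proj₂)
  open import Data.Sum using (inj₂)
  open import Function using (_∘_)
  open import Relation.Nullary using (yes; no)
  open import Relation.Binary.PropositionalEquality as ≡ using (_≡_; _≢_)
  open import Defs using (IsFilling; φ)
  open Transpositions
  open Fillings
  import Relation.Binary.Reasoning.Setoid

  open CommutativeRing R hiding (zero)
  open BigOperators R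
  open Determinant R
  open WithTwoInvertible two⁻¹
  open Span R d n
  open Relation.Binary.Reasoning.Setoid setoid

  Label : Set
  Label = Fin (d ℕ.* n)

  swap : Label → Label → Array d n → Array d n
  swap X Y = relabel (Perm.transpose X Y)

  module InFilling {U : Array d n} (U-filling : IsFilling d n U) where
    open Filling U-filling

    detProduct-swap-in-row : ∀ {X Y} → X ≢ Y → row X ≡ row Y → ∀ v → detProduct (swap X Y U) v ≈ - detProduct U v
    detProduct-swap-in-row {X} {Y} X≢Y same-row v = trans (∏-scale-at (row X) other-rows swapped-row) (-1*x≈-x _)
      where
      i = row X
      a = column X
      b = column Y
      a≢b : a ≢ b
      a≢b a≡b = X≢Y (≡.trans (≡.sym (at-position X)) (≡.trans (≡.cong (U i) a≡b) (at-row (≡.sym same-row))))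
      in-row : ∀ s → transpose X Y (U i s) ≡ U i (transpose a b s)
      in-row s with transposeView a b s
      ... | at-i ≡.refl = ≡.trans (≡.cong (transpose X Y) (at-position X))
                            (≡.trans (transpose-i X Y) (≡.trans (≡.sym (at-row (≡.sym same-row))) (≡.cong (U i) (≡.sym (transpose-i s b)))))
      ... | at-j ≡.refl _ = ≡.trans (≡.cong (transpose X Y) (at-row (≡.sym same-row)))
                            (≡.trans (transpose-j X Y) (≡.trans (≡.sym (at-position X)) (≡.cong (U i) (≡.sym (transpose-j a s)))))
      ... | elsewhere s≢a s≢b = ≡.trans (transpose-other X Y (s≢a ∘ ≡.sym ∘ proj₂ ∘ position-unique)
                                                            (s≢b ∘ ≡.sym ∘ proj₂ ∘ position-unique))
                                        (≡.cong (U i) (≡.sym (transpose-other a b s≢a s≢b)))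
      swapped-row : Det (λ r s → v (transpose X Y (U i s)) r) ≈ - 1# * Det (λ r s → v (U i s) r)
      swapped-row = begin
        Det (λ r s → v (transpose X Y (U i s)) r) ≈⟨ det-cong≡ (λ r s → ≡.cong (λ k → v k r) (in-row s)) ⟩
        Det (λ r s → v (U i (transpose a b s)) r) ≈⟨ det-transpose-columns a≢b (λ r s → v (U i s) r) ⟩
        - Det (λ r s → v (U i s) r)               ≈⟨ -1*x≈-x _ ⟨
        - 1# * Det (λ r s → v (U i s) r)          ∎
      other-rows : ∀ k → k ≢ i → Det (λ r s → v (transpose X Y (U k s)) r) ≈ Det (λ r s → v (U k s) r)
      other-rows k k≢i = det-cong≡ (λ r s → ≡.cong (λ l → v l r) (transpose-other X Y
        (k≢i ∘ ≡.sym ∘ proj₁ ∘ position-unique)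
        (k≢i ∘ ≡.sym ∘ ≡.trans same-row ∘ proj₁ ∘ position-unique)))

    module AcrossRows {X Y : Label} (X≢Y : X ≢ Y) (rows≢ : row X ≢ row Y) where
      i = row X
      i′ = row Y
      p = column X
      q₀ = column Y

      exchanged : Fin n → Array d n
      exchanged q = swap X (U i′ q) U

      exchanged-filling : ∀ q → IsFilling d n (exchanged q)
      exchanged-filling q = relabel-filling (Perm.transpose X (U i′ q)) U-filling

      X∈exchanged : ∀ q → exchanged q i′ q ≡ X
      X∈exchanged q = transpose-j X (U i′ q)

      Y∈exchanged : ∀ {q} → q ≢ q₀ → exchanged q i′ q₀ ≡ Y
      Y∈exchanged {q} q≢q₀ = ≡.trans (≡.cong (transpose X (U i′ q)) (at-row ≡.refl))
        (transpose-other X (U i′ q) (X≢Y ∘ ≡.sym) (λ Y≡ → q≢q₀ (≡.sym (proj₂ (injective (≡.trans (at-row ≡.refl) Y≡))))))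

      exchanged-q₀ : ∀ r s → exchanged q₀ r s ≡ swap X Y U r s
      exchanged-q₀ r s = ≡.cong (λ k → transpose X k (U r s)) (at-row ≡.refl)

      plücker-rows : ∀ v → detProduct U v ≈ ∑ (λ q → detProduct (exchanged q) v)
      plücker-rows v = begin
        ∏ f                                                                                      ≈⟨ ∏-extract₂ rows≢ f ⟩
        (f i * f i′) * rest                                                                      ≈⟨ *-congʳ (plücker A B p) ⟩
        ∑ (λ q → Det (withColumn p (λ r → B r q) A) * Det (withColumn q (λ r → A r p) B)) * rest ≈⟨ *-distribʳ-∑ rest _ ⟩
        ∑ (λ q → (Det (withColumn p (λ r → B r q) A) * Det (withColumn q (λ r → A r p) B)) * rest)
          ≈⟨ ∑-cong (λ q → *-cong (*-cong (det-cong≡ (row-i q)) (det-cong≡ (row-i′ q)))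
                                  (∏-cong ([]≔₂-cong (λ r r≢i r≢i′ → det-cong≡ (other-rows q r r≢i r≢i′))))) ⟨
        ∑ (λ q → (g q i * g q i′) * ∏ ((g q [ i ]≔ 1#) [ i′ ]≔ 1#)) ≈⟨ ∑-cong (λ q → ∏-extract₂ rows≢ (g q)) ⟨
        ∑ (λ q → ∏ (g q))                                           ∎
        where
        A B : Matrix n
        A r s = v (U i s) r
        B r s = v (U i′ s) r
        f : Fin d → Carrier
        f r = Det (λ r′ s → v (U r s) r′)
        g : Fin n → Fin d → Carrier
        g q r = Det (λ r′ s → v (exchanged q r s) r′)
        rest = ∏ ((f [ i ]≔ 1#) [ i′ ]≔ 1#)
        row-i : ∀ q r s → v (exchanged q i s) r ≡ withColumn p (λ r → B r q) A r s
        row-i q r s with s ≟ p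
        ... | yes ≡.refl = ≡.trans (≡.cong (λ k → v (transpose X (U i′ q) k) r) (at-position X))
                                   (≡.trans (≡.cong (λ k → v k r) (transpose-i X (U i′ q))) (≡.sym (withColumn-at s (λ r → B r q) A r)))
        ... | no s≢p     = ≡.trans (≡.cong (λ k → v k r) (transpose-other X (U i′ q)
                                     (s≢p ∘ ≡.sym ∘ proj₂ ∘ position-unique) (rows≢ ∘ proj₁ ∘ injective)))
                                   (≡.sym (withColumn-elsewhere (λ r → B r q) A r s≢p))
        row-i′ : ∀ q r s → v (exchanged q i′ s) r ≡ withColumn q (λ r → A r p) B r s
        row-i′ q r s with s ≟ q
        ... | yes ≡.refl = ≡.trans (≡.cong (λ k → v k r) (≡.trans (transpose-j X (U i′ s)) (≡.sym (at-position X))))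
                                   (≡.sym (withColumn-at s (λ r → A r p) B r))
        ... | no s≢q     = ≡.trans (≡.cong (λ k → v k r) (transpose-other X (U i′ q)
                                     (rows≢ ∘ proj₁ ∘ position-unique) (s≢q ∘ proj₂ ∘ injective)))
                                   (≡.sym (withColumn-elsewhere (λ r → A r p) B r s≢q))
        other-rows : ∀ q r → r ≢ i → r ≢ i′ → ∀ r′ s → v (exchanged q r s) r′ ≡ v (U r s) r′
        other-rows q r r≢i r≢i′ r′ s = ≡.cong (λ k → v k r′) (transpose-other X (U i′ q)
          (r≢i ∘ ≡.sym ∘ proj₁ ∘ position-unique) (r≢i′ ∘ proj₁ ∘ injective))

      exchange : ∀ v → detProduct (swap X Y U) v ≈ detProduct U v + - ∑ ((λ q → detProduct (exchanged q) v) [ q₀ ]≔ 0#)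
      exchange v = begin
        detProduct (swap X Y U) v                   ≈⟨ +-identityʳ _ ⟨
        detProduct (swap X Y U) v + 0#              ≈⟨ +-congˡ (-‿inverseʳ rest) ⟨
        detProduct (swap X Y U) v + (rest + - rest) ≈⟨ +-assoc _ _ _ ⟨
        (detProduct (swap X Y U) v + rest) + - rest ≈⟨ +-congʳ split ⟨
        detProduct U v + - rest                     ∎
        where
        terms : Fin n → Carrier
        terms q = detProduct (exchanged q) v
        rest = ∑ (terms [ q₀ ]≔ 0#)
        split : detProduct U v ≈ detProduct (swap X Y U) v + rest
        split = trans (plücker-rows v) (trans (∑-extract q₀ terms)
          (+-congʳ (∏-cong (λ r → det-cong≡ (λ r′ s → ≡.cong (λ k → v k r′) (exchanged-q₀ r s))))))

  private
    [a-o]*-b≈-1*ab+ob : ∀ a o b → (a + - o) * - b ≈ - 1# * (a * b) + o * b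
    [a-o]*-b≈-1*ab+ob a o b = begin
      (a + - o) * - b         ≈⟨ -‿distribʳ-* _ b ⟨
      - ((a + - o) * b)       ≈⟨ -‿cong (distribʳ b a (- o)) ⟩
      - (a * b + - o * b)     ≈⟨ -‿+-comm _ _ ⟨
      - (a * b) + - (- o * b) ≈⟨ +-cong (-1*x≈-x _) (sym (trans (-‿cong (sym (-‿distribˡ-* o b))) (-‿involutive _))) ⟨
      - 1# * (a * b) + o * b  ∎

    -a*[b-o]≈-1*ab+ao : ∀ a b o → - a * (b + - o) ≈ - 1# * (a * b) + a * o
    -a*[b-o]≈-1*ab+ao a b o = begin
      - a * (b + - o)         ≈⟨ -‿distribˡ-* a _ ⟨
      - (a * (b + - o))       ≈⟨ -‿cong (distribˡ a b (- o)) ⟩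
      - (a * b + a * - o)     ≈⟨ -‿+-comm _ _ ⟨
      - (a * b) + - (a * - o) ≈⟨ +-cong (-1*x≈-x _) (sym (trans (-‿cong (sym (-‿distribʳ-* a o))) (-‿involutive _))) ⟨
      - 1# * (a * b) + a * o  ∎

  module _ {S T : Array d n} (S-filling : IsFilling d n S) (T-filling : IsFilling d n T) where
    private
      module S = Filling S-filling
      module T = Filling T-filling

    swap-in-T-row : ∀ {X Y} → X ≢ Y → S.row X ≢ S.row Y → T.row X ≡ T.row Y →
                    φ R (swap X Y S) (swap X Y T) ≃ - 1# · φ R S T mod𝔐
    swap-in-T-row {X} {Y} X≢Y S-rows≢ same-T-row = r , r∈φ𝔐 , φ-swapped
      where
      open InFilling S-filling
      open AcrossRows X≢Y S-rows≢
      others : Vectors → Carrier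
      others v = ∑ ((λ q → detProduct (exchanged q) v) [ q₀ ]≔ 0#)
      r : Form
      r v w = others v * detProduct T w
      term∈φ𝔐 : ∀ q → Inφ𝔐 (λ v w → ((λ q → detProduct (exchanged q) v) [ q₀ ]≔ 0#) q * detProduct T w)
      term∈φ𝔐 q with q ≟ q₀
      ... | yes ≡.refl = inφ𝔐-cong (λ v w → trans (*-congʳ (reflexive ([]≔-at _ q))) (zeroˡ _)) inφ𝔐-0
      ... | no q≢q₀ = inφ𝔐-cong (λ v w → trans (*-congʳ (reflexive ([]≔-elsewhere _ q≢q₀))) (sym (φ≈detProduct _ T v w)))
        (inM⇒inφ𝔐 (exchanged-filling q) T-filling (inj₂ (TableauOf.multipleEdge (exchanged-filling q) T-filling X≢Y
          (≡.trans (proj₁ (Q.position-unique (X∈exchanged q))) (≡.sym (proj₁ (Q.position-unique (Y∈exchanged q≢q₀)))))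
          same-T-row)))
        where module Q = Filling (exchanged-filling q)
      r∈φ𝔐 : Inφ𝔐 r
      r∈φ𝔐 = inφ𝔐-cong (λ v w → *-distribʳ-∑ _ _) (inφ𝔐-∑ _ term∈φ𝔐)
      φ-swapped : ∀ v w → φ R (swap X Y S) (swap X Y T) v w ≈ - 1# * φ R S T v w + r v w
      φ-swapped v w = begin
        φ R (swap X Y S) (swap X Y T) v w                     ≈⟨ φ≈detProduct _ _ v w ⟩
        detProduct (swap X Y S) v * detProduct (swap X Y T) w ≈⟨ *-cong (exchange v) (InFilling.detProduct-swap-in-row T-filling X≢Y same-T-row w) ⟩
        (detProduct S v + - others v) * - detProduct T w      ≈⟨ [a-o]*-b≈-1*ab+ob _ _ _ ⟩
        - 1# * (detProduct S v * detProduct T w) + r v w      ≈⟨ +-congʳ (*-congˡ (φ≈detProduct S T v w)) ⟨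
        - 1# * φ R S T v w + r v w                            ∎

    swap-in-S-row : ∀ {X Y} → X ≢ Y → S.row X ≡ S.row Y → T.row X ≢ T.row Y →
                    φ R (swap X Y S) (swap X Y T) ≃ - 1# · φ R S T mod𝔐
    swap-in-S-row {X} {Y} X≢Y same-S-row T-rows≢ = r , r∈φ𝔐 , φ-swapped
      where
      open InFilling T-filling
      open AcrossRows X≢Y T-rows≢
      others : Vectors → Carrier
      others w = ∑ ((λ q → detProduct (exchanged q) w) [ q₀ ]≔ 0#)
      r : Form
      r v w = detProduct S v * others w
      term∈φ𝔐 : ∀ q → Inφ𝔐 (λ v w → detProduct S v * ((λ q → detProduct (exchanged q) w) [ q₀ ]≔ 0#) q)
      term∈φ𝔐 q with q ≟ q₀
      ... | yes ≡.refl = inφ𝔐-cong (λ v w → trans (*-congˡ (reflexive ([]≔-at _ q))) (zeroʳ _)) inφ𝔐-0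
      ... | no q≢q₀ = inφ𝔐-cong (λ v w → trans (*-congˡ (reflexive ([]≔-elsewhere _ q≢q₀))) (sym (φ≈detProduct S _ v w)))
        (inM⇒inφ𝔐 S-filling (exchanged-filling q) (inj₂ (TableauOf.multipleEdge S-filling (exchanged-filling q) X≢Y
          same-S-row
          (≡.trans (proj₁ (Q.position-unique (X∈exchanged q))) (≡.sym (proj₁ (Q.position-unique (Y∈exchanged q≢q₀))))))))
        where module Q = Filling (exchanged-filling q)
      r∈φ𝔐 : Inφ𝔐 r
      r∈φ𝔐 = inφ𝔐-cong (λ v w → *-distribˡ-∑ _ _) (inφ𝔐-∑ _ term∈φ𝔐)
      φ-swapped : ∀ v w → φ R (swap X Y S) (swap X Y T) v w ≈ - 1# * φ R S T v w + r v w
      φ-swapped v w = begin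
        φ R (swap X Y S) (swap X Y T) v w                     ≈⟨ φ≈detProduct _ _ v w ⟩
        detProduct (swap X Y S) v * detProduct (swap X Y T) w ≈⟨ *-cong (InFilling.detProduct-swap-in-row S-filling X≢Y same-S-row v) (exchange w) ⟩
        - detProduct S v * (detProduct T w + - others w)      ≈⟨ -a*[b-o]≈-1*ab+ao _ _ _ ⟩
        - 1# * (detProduct S v * detProduct T w) + r v w      ≈⟨ +-congʳ (*-congˡ (φ≈detProduct S T v w)) ⟨
        - 1# * φ R S T v w + r v w                            ∎

module Antisymmetry {c ℓ : Level} (R : CommutativeRing c ℓ) (d n : ℕ) (two⁻¹ : Determinant.TwoInvertible R)
             {S₀ T₀ : Fillings.Array d n} (S₀-filling : IsFilling d n S₀) (T₀-filling : IsFilling d n T₀)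
             (simple : ¬ HasMultipleEdge (Fillings.TableauOf.C S₀-filling T₀-filling)) where
  open import Data.Nat as ℕ using (ℕ)
  open import Data.Fin.Properties using (_≟_)
  open import Data.Fin.Permutation as Perm using (Permutation′; _⟨$⟩ʳ_; _∘ₚ_)
  open import Data.Fin.Permutation.Components using (transpose)
  open import Data.List using (List; []; _∷_; length)
  open import Data.Product using (Σ-syntax; _×_; _,_; proj₁)
  open import Data.Sum using (inj₁; inj₂)
  open import Data.Empty using (⊥; ⊥-elim)
  open import Function using (_∘_)
  open import Relation.Nullary using (¬_; yes; no)
  open import Relation.Binary.Construct.Closure.ReflexiveTransitive using (Star; ε; _◅_)
  open import Relation.Binary.PropositionalEquality as ≡ using (_≡_; _≢_)
  open import Defs using (IsFilling; φ; HasMultipleEdge)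
  open Transpositions
  open Fillings
  open Connectivity

  open CommutativeRing R hiding (zero)
  open BigOperators R
  open Determinant R
  open Span R d n
  open Exchange R d n two⁻¹
  open TableauGraph S₀-filling T₀-filling using (Linked)
  private
    module S₀ = Filling S₀-filling
    module T₀ = Filling T₀-filling

  φ[_] : Permutation′ (d ℕ.* n) → Form
  φ[ σ ] = φ R (relabel σ S₀) (relabel σ T₀)

  φ[]-cong : ∀ {σ τ} → (∀ k → σ ⟨$⟩ʳ k ≡ τ ⟨$⟩ʳ k) → ∀ v w → φ[ σ ] v w ≈ φ[ τ ] v w
  φ[]-cong σ≗τ v w = φ-cong≡ (λ i s → σ≗τ (S₀ i s)) (λ j s → σ≗τ (T₀ j s)) v w

  AntisymmetricIn : Label → Label → Set (c ⊔ ℓ)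
  AntisymmetricIn x y = ∀ σ → φ[ Perm.transpose x y ∘ₚ σ ] ≃ - 1# · φ[ σ ] mod𝔐

  linked⇒antisymmetric : ∀ {x y} → x ≢ y → Linked x y → AntisymmetricIn x y
  linked⇒antisymmetric {x} {y} x≢y linked σ = ≃-congˡ relabelled (swapped linked)
    where
    Sσ Tσ : Array d n
    Sσ = relabel σ S₀
    Tσ = relabel σ T₀
    Sσ-filling = relabel-filling σ S₀-filling
    Tσ-filling = relabel-filling σ T₀-filling
    module Sσ = Filling Sσ-filling
    module Tσ = Filling Tσ-filling
    X Y : Label
    X = σ ⟨$⟩ʳ x
    Y = σ ⟨$⟩ʳ y
    σ-injective : ∀ {a b} → σ ⟨$⟩ʳ a ≡ σ ⟨$⟩ʳ b → a ≡ b
    σ-injective e = ≡.trans (≡.sym (Perm.inverseˡ σ)) (≡.trans (≡.cong (σ Perm.⟨$⟩ˡ_) e) (Perm.inverseˡ σ))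
    S-row : ∀ z → Sσ.row (σ ⟨$⟩ʳ z) ≡ S₀.row z
    S-row z = proj₁ (Sσ.position-unique (≡.cong (σ ⟨$⟩ʳ_) (S₀.at-position z)))
    T-row : ∀ z → Tσ.row (σ ⟨$⟩ʳ z) ≡ T₀.row z
    T-row z = proj₁ (Tσ.position-unique (≡.cong (σ ⟨$⟩ʳ_) (T₀.at-position z)))
    not-both : S₀.row x ≡ S₀.row y → T₀.row x ≡ T₀.row y → ⊥
    not-both same-S same-T = simple (TableauOf.multipleEdge S₀-filling T₀-filling x≢y same-S same-T)
    swapped : Linked x y → φ R (swap X Y Sσ) (swap X Y Tσ) ≃ - 1# · φ[ σ ] mod𝔐
    swapped (inj₁ same-S) = swap-in-S-row Sσ-filling Tσ-filling (x≢y ∘ σ-injective)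
      (≡.trans (S-row x) (≡.trans same-S (≡.sym (S-row y))))
      (λ same-T → not-both same-S (≡.trans (≡.sym (T-row x)) (≡.trans same-T (T-row y))))
    swapped (inj₂ same-T) = swap-in-T-row Sσ-filling Tσ-filling (x≢y ∘ σ-injective)
      (λ same-S → not-both (≡.trans (≡.sym (S-row x)) (≡.trans same-S (S-row y))) same-T)
      (≡.trans (T-row x) (≡.trans same-T (≡.sym (T-row y))))
    relabelled : ∀ v w → φ[ Perm.transpose x y ∘ₚ σ ] v w ≈ φ R (swap X Y Sσ) (swap X Y Tσ) v w
    relabelled = φ-cong≡ (λ i s → ≡.sym (transpose-natural (σ ⟨$⟩ʳ_) σ-injective x y (S₀ i s)))
                         (λ j s → ≡.sym (transpose-natural (σ ⟨$⟩ʳ_) σ-injective x y (T₀ j s)))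

  -- Along a path x ∼ z ⇝ y, conjugate: (x y) = (x z) (z y) (x z).
  path⇒antisymmetric : ∀ {x y} → Star Linked x y → x ≢ y → AntisymmetricIn x y
  path⇒antisymmetric ε x≢x = ⊥-elim (x≢x ≡.refl)
  path⇒antisymmetric {x} {y} (_◅_ {j = z} x∼z z⇝y) x≢y with z ≟ y | z ≟ x
  ... | yes ≡.refl | _          = linked⇒antisymmetric x≢y x∼z
  ... | no z≢y     | yes ≡.refl = path⇒antisymmetric z⇝y x≢y
  ... | no z≢y     | no z≢x     = λ σ → ≃-coeff (-1³≈-1) (≃-congˡ (φ[]-cong {τ σ} {Perm.transpose x z ∘ₚ τ₂ σ} (conjugate σ))
    (≃-trans (linked⇒antisymmetric x≢z x∼z (τ₂ σ))
    (≃-trans (path⇒antisymmetric z⇝y z≢y (τ₁ σ))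
             (linked⇒antisymmetric x≢z x∼z σ))))
    where
    x≢z : x ≢ z
    x≢z = z≢x ∘ ≡.sym
    τ τ₁ τ₂ : Permutation′ (d ℕ.* n) → Permutation′ (d ℕ.* n)
    τ σ = Perm.transpose x y ∘ₚ σ
    τ₁ σ = Perm.transpose x z ∘ₚ σ
    τ₂ σ = Perm.transpose z y ∘ₚ τ₁ σ
    conjugate : ∀ σ k → τ σ ⟨$⟩ʳ k ≡ (Perm.transpose x z ∘ₚ τ₂ σ) ⟨$⟩ʳ k
    conjugate σ k = ≡.cong (σ ⟨$⟩ʳ_) (transpose-conj x≢y x≢z (z≢y ∘ ≡.sym) k)
    -1³≈-1 : - 1# * (- 1# * - 1#) ≈ - 1#
    -1³≈-1 = trans (*-congˡ (trans (-1*x≈-x _) (-‿involutive _))) (*-identityʳ _)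

  Transposition : Set
  Transposition = Σ[ (x , y) ∈ Label × Label ] x ≢ y

  -- word ((x , y) ∷ ts) applies word ts first, then (x y).
  word : List Transposition → Permutation′ (d ℕ.* n)
  word []                  = Perm.id
  word (((x , y) , _) ∷ ts) = word ts ∘ₚ Perm.transpose x y

  module Connected (paths : ∀ x y → Star Linked x y) where

    φ[word]≃sign : ∀ ts σ → φ[ word ts ∘ₚ σ ] ≃ sign (length ts) · φ[ σ ] mod𝔐
    φ[word]≃sign []                      σ = ≃-refl
    φ[word]≃sign (((x , y) , x≢y) ∷ ts) σ = ≃-coeff (trans (*-comm _ _) (-1*x≈-x _))
      (≃-trans (φ[word]≃sign ts (Perm.transpose x y ∘ₚ σ)) (path⇒antisymmetric (paths x y) x≢y σ))

module Multilinear {c ℓ : Level} (R : CommutativeRing c ℓ) (n : ℕ) where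
  open import Data.Nat using (ℕ; zero; suc)
  open import Data.Fin using (Fin; zero; suc)
  open import Data.Fin.Properties using (_≟_)
  open import Data.Vec.Functional using (_∷_)
  open import Data.Empty using (⊥-elim)
  open import Function using (_∘_)
  open import Relation.Nullary using (yes; no)
  open import Relation.Binary.PropositionalEquality as ≡ using (_≡_; _≢_)
  open LehmerCodes
  import Relation.Binary.Reasoning.Setoid

  open CommutativeRing R hiding (zero)
  open BigOperators R
  open Determinant R using (∑Code; ∑Code-cong; ∑Code-∑)
  open Relation.Binary.Reasoning.Setoid setoid

  Vector : Set c
  Vector = Fin n → Carrier

  update-cong : ∀ {m} (u : Fin m → Vector) k {x y : Vector} → (∀ r → x r ≈ y r) → ∀ k′ r → (u [ k ]≔ x) k′ r ≈ (u [ k ]≔ y) k′ r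
  update-cong u k {x} {y} x≈y k′ r with k′ ≟ k
  ... | yes ≡.refl = trans (reflexive (≡.cong (λ z → z r) ([]≔-at u k′)))
                           (trans (x≈y r) (reflexive (≡.cong (λ z → z r) (≡.sym ([]≔-at u k′)))))
  ... | no k′≢k    = reflexive (≡.cong (λ z → z r) (≡.trans ([]≔-elsewhere u k′≢k) (≡.sym ([]≔-elsewhere u k′≢k))))

  record IsMultilinear {m} (F : (Fin m → Vector) → Carrier) : Set (c ⊔ ℓ) where
    field
      cong        : ∀ {u u′} → (∀ k r → u k r ≈ u′ k r) → F u ≈ F u′
      additive    : ∀ k u (x y : Vector) → F (u [ k ]≔ (λ r → x r + y r)) ≈ F (u [ k ]≔ x) + F (u [ k ]≔ y)
      homogeneous : ∀ k u a (x : Vector) → F (u [ k ]≔ (λ r → a * x r)) ≈ a * F (u [ k ]≔ x)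

    update-congʳ : ∀ k u {x y : Vector} → (∀ r → x r ≈ y r) → F (u [ k ]≔ x) ≈ F (u [ k ]≔ y)
    update-congʳ k u x≈y = cong (update-cong u k x≈y)

    linear-∑ : ∀ k u {K} (a : Fin K → Carrier) (x : Fin K → Vector) →
               F (u [ k ]≔ (λ r → ∑ (λ b → a b * x b r))) ≈ ∑ (λ b → a b * F (u [ k ]≔ x b))
    linear-∑ k u {zero} a x = begin
      F (u [ k ]≔ (λ r → ∑ (λ b → a b * x b r))) ≈⟨ update-congʳ k u (λ r → trans (∑-empty _) (sym (zeroˡ 0#))) ⟩
      F (u [ k ]≔ (λ r → 0# * 0#))               ≈⟨ homogeneous k u 0# (λ _ → 0#) ⟩
      0# * F (u [ k ]≔ (λ _ → 0#))               ≈⟨ zeroˡ _ ⟩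
      0#                                         ≈⟨ ∑-empty _ ⟨
      ∑ (λ b → a b * F (u [ k ]≔ x b))           ∎
    linear-∑ k u {suc K} a x = begin
      F (u [ k ]≔ (λ r → ∑ (λ b → a b * x b r)))
        ≈⟨ update-congʳ k u (λ r → ∑-suc _) ⟩
      F (u [ k ]≔ (λ r → a zero * x zero r + ∑ (λ b → a (suc b) * x (suc b) r)))
        ≈⟨ additive k u _ _ ⟩
      F (u [ k ]≔ (λ r → a zero * x zero r)) + F (u [ k ]≔ (λ r → ∑ (λ b → a (suc b) * x (suc b) r)))
        ≈⟨ +-cong (homogeneous k u (a zero) (x zero)) (linear-∑ k u (a ∘ suc) (x ∘ suc)) ⟩
      a zero * F (u [ k ]≔ x zero) + ∑ (λ b → a (suc b) * F (u [ k ]≔ x (suc b))) ≈⟨ ∑-suc _ ⟨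
      ∑ (λ b → a b * F (u [ k ]≔ x b))                                            ∎

  fixFirst : ∀ {m} {F : (Fin (suc m) → Vector) → Carrier} → IsMultilinear F → (x₀ : Vector) → IsMultilinear (λ u → F (x₀ ∷ u))
  fixFirst {F = F} F-multilinear x₀ = record
    { cong        = λ u≈u′ → cong (λ { zero r → refl ; (suc k) r → u≈u′ k r })
    ; additive    = λ k u x y → trans (cong (shift k u _)) (trans (additive (suc k) (x₀ ∷ u) x y)
                                   (+-cong (sym (cong (shift k u x))) (sym (cong (shift k u y)))))
    ; homogeneous = λ k u a x → trans (cong (shift k u _)) (trans (homogeneous (suc k) (x₀ ∷ u) a x) (*-congˡ (sym (cong (shift k u x)))))
    }
    where
    open IsMultilinear F-multilinear
    shift : ∀ k u x k′ r → (x₀ ∷ (u [ k ]≔ x)) k′ r ≈ ((x₀ ∷ u) [ suc k ]≔ x) k′ r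
    shift k u x zero     r = refl
    shift k u x (suc k′) r = refl

  basis : Fin n → Vector
  basis b r with r ≟ b
  ... | yes _ = 1#
  ... | no _  = 0#

  basis-elsewhere : ∀ {b r} → r ≢ b → basis b r ≡ 0#
  basis-elsewhere {b} {r} r≢b with r ≟ b
  ... | yes r≡b = ⊥-elim (r≢b r≡b)
  ... | no _    = ≡.refl

  x≈∑basis : ∀ (x : Vector) r → x r ≈ ∑ (λ b → x b * basis b r)
  x≈∑basis x r = begin
    x r                                   ≈⟨ *-identityʳ _ ⟨
    x r * 1#                              ≈⟨ *-congˡ (reflexive (≡.sym basis-diagonal)) ⟩
    x r * basis r r                       ≈⟨ +-identityʳ _ ⟨
    x r * basis r r + 0#                  ≈⟨ +-congˡ (∑-zero off-diagonal) ⟨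
    x r * basis r r + ∑ (terms [ r ]≔ 0#) ≈⟨ ∑-extract r terms ⟨
    ∑ terms                               ∎
    where
    terms = λ b → x b * basis b r
    basis-diagonal : basis r r ≡ 1#
    basis-diagonal with r ≟ r
    ... | yes _  = ≡.refl
    ... | no r≢r = ⊥-elim (r≢r ≡.refl)
    off-diagonal : ∀ b → (terms [ r ]≔ 0#) b ≈ 0#
    off-diagonal b with b ≟ r
    ... | yes ≡.refl = reflexive ([]≔-at terms b)
    ... | no b≢r     = trans (reflexive ([]≔-elsewhere terms b≢r)) (trans (*-congˡ (reflexive (basis-elsewhere (b≢r ∘ ≡.sym)))) (zeroʳ _))

  ∑Map : ∀ {m} → ((Fin m → Fin n) → Carrier) → Carrier
  ∑Map {zero}  g = g (λ ())
  ∑Map {suc m} g = ∑ (λ b → ∑Map (λ a → g (b ∷ a)))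

  ∑Map-cong : ∀ {m} {f g : (Fin m → Fin n) → Carrier} → (∀ a → f a ≈ g a) → ∑Map f ≈ ∑Map g
  ∑Map-cong {zero}  f≈g = f≈g _
  ∑Map-cong {suc m} f≈g = ∑-cong (λ b → ∑Map-cong (λ a → f≈g (b ∷ a)))

  *-distribˡ-∑Map : ∀ {m} x (f : (Fin m → Fin n) → Carrier) → x * ∑Map f ≈ ∑Map (λ a → x * f a)
  *-distribˡ-∑Map {zero}  x f = refl
  *-distribˡ-∑Map {suc m} x f = trans (*-distribˡ-∑ x _) (∑-cong (λ b → *-distribˡ-∑Map x (λ a → f (b ∷ a))))

  *-distribʳ-∑Map : ∀ {m} x (f : (Fin m → Fin n) → Carrier) → ∑Map f * x ≈ ∑Map (λ a → f a * x)
  *-distribʳ-∑Map x f = trans (*-comm _ x) (trans (*-distribˡ-∑Map x f) (∑Map-cong (λ a → *-comm x (f a))))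

  ∑Map-zero : ∀ {m} {f : (Fin m → Fin n) → Carrier} → (∀ a → f a ≈ 0#) → ∑Map f ≈ 0#
  ∑Map-zero {zero}  f≈0 = f≈0 _
  ∑Map-zero {suc m} f≈0 = ∑-zero (λ b → ∑Map-zero (λ a → f≈0 (b ∷ a)))

  ∑Code-∑Map : ∀ {k m} (f : LehmerCode k → (Fin m → Fin n) → Carrier) →
               ∑Code (λ π → ∑Map (f π)) ≈ ∑Map (λ a → ∑Code (λ π → f π a))
  ∑Code-∑Map {m = zero}  f = refl
  ∑Code-∑Map {m = suc m} f = trans (∑Code-∑ (λ π b → ∑Map (λ a → f π (b ∷ a))))
                                   (∑-cong (λ b → ∑Code-∑Map (λ π a → f π (b ∷ a))))

  multilinear-expansion : ∀ {m} {F : (Fin m → Vector) → Carrier} → IsMultilinear F →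
                          ∀ u → F u ≈ ∑Map (λ a → ∏ (λ k → u k (a k)) * F (basis ∘ a))
  multilinear-expansion {zero} F-multilinear u = trans (IsMultilinear.cong F-multilinear (λ ())) (sym (trans (*-congʳ (∏-empty _)) (*-identityˡ _)))
  multilinear-expansion {suc m} {F} F-multilinear u = begin
    F u                                                    ≈⟨ cong (λ { zero r → x≈∑basis (u zero) r ; (suc k) r → refl }) ⟩
    F (u [ zero ]≔ (λ r → ∑ (λ b → u zero b * basis b r))) ≈⟨ linear-∑ zero u (u zero) basis ⟩
    ∑ (λ b → u zero b * F (u [ zero ]≔ basis b))           ≈⟨ ∑-cong (λ b → *-congˡ (cong (λ { zero r → refl ; (suc k) r → refl }))) ⟩
    ∑ (λ b → u zero b * F (basis b ∷ (u ∘ suc)))           ≈⟨ ∑-cong (λ b → *-congˡ (multilinear-expansion (fixFirst F-multilinear (basis b)) (u ∘ suc))) ⟩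
    ∑ (λ b → u zero b * ∑Map (λ a → ∏ (λ k → u (suc k) (a k)) * F (basis b ∷ (basis ∘ a))))
      ≈⟨ ∑-cong (λ b → trans (*-distribˡ-∑Map {m} _ _) (∑Map-cong {m} (λ a → trans (sym (*-assoc _ _ _)) (*-cong (sym (∏-suc _))
                         (cong (λ { zero r → refl ; (suc k) r → refl })))))) ⟩
    ∑Map (λ a → ∏ (λ k → u k (a k)) * F (basis ∘ a))        ∎
    where open IsMultilinear F-multilinear

module Vanishing {c ℓ : Level} (R : CommutativeRing c ℓ) (d n : ℕ) (two⁻¹ : Determinant.TwoInvertible R) where
  open import Data.Nat as ℕ using (ℕ)
  import Data.Nat.Properties as ℕ
  open import Data.Fin as Fin using (Fin; combine)
  open import Data.Fin.Properties using (_≟_; pigeonhole; combine-injective)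
  open import Data.Product using (_×_; _,_; proj₁; proj₂)
  open import Function using (_∘_)
  open import Relation.Nullary using (yes; no)
  open import Relation.Binary.PropositionalEquality as ≡ using (_≡_; _≢_)
  open import Defs using (IsFilling)
  open LehmerCodes
  open Fillings
  import Relation.Binary.Reasoning.Setoid

  open CommutativeRing R hiding (zero)
  open BigOperators R
  open Determinant R
  open WithTwoInvertible two⁻¹
  open Span R d n
  open Multilinear R n
  open Relation.Binary.Reasoning.Setoid setoid

  detProduct-multilinear : ∀ {S : Array d n} → IsFilling d n S → IsMultilinear (detProduct S)
  detProduct-multilinear {S} S-filling = record
    { cong        = λ u≈u′ → ∏-cong (λ i → det-cong (λ r s → u≈u′ (S i s) r))
    ; additive    = λ k u x y → ∏-add-at (row k) (other-row k u) (other-row k u)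
        (trans (det-cong≡ (updated-row k u _)) (trans (det-withColumn-+ (column k) x y (rowMatrix u (row k)))
          (sym (+-cong (det-cong≡ (updated-row k u x)) (det-cong≡ (updated-row k u y))))))
    ; homogeneous = λ k u a x → ∏-scale-at (row k) (other-row k u)
        (trans (det-cong≡ (updated-row k u _)) (trans (det-withColumn-* (column k) a x (rowMatrix u (row k)))
          (*-congˡ (sym (det-cong≡ (updated-row k u x))))))
    }
    where
    open Filling S-filling
    rowMatrix : (Fin (d ℕ.* n) → Vector) → Fin d → Matrix n
    rowMatrix u i r s = u (S i s) r
    updated-row : ∀ k u x r s → rowMatrix (u [ k ]≔ x) (row k) r s ≡ withColumn (column k) x (rowMatrix u (row k)) r s
    updated-row k u x r s with s ≟ column k
    ... | yes ≡.refl = ≡.trans (≡.cong (λ l → (u [ k ]≔ x) l r) (at-position k))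
                               (≡.trans (≡.cong (λ z → z r) ([]≔-at u k)) (≡.sym (withColumn-at s x (rowMatrix u (row k)) r)))
    ... | no s≢k     = ≡.trans (≡.cong (λ z → z r) ([]≔-elsewhere u (s≢k ∘ ≡.sym ∘ proj₂ ∘ position-unique)))
                               (≡.sym (withColumn-elsewhere x (rowMatrix u (row k)) r s≢k))
    other-row : ∀ k u {x y} i → i ≢ row k → Det (rowMatrix (u [ k ]≔ x) i) ≈ Det (rowMatrix (u [ k ]≔ y) i)
    other-row k u i i≢row = det-cong≡ (λ r s → ≡.cong (λ z → z r)
      (≡.trans ([]≔-elsewhere u (i≢row ∘ ≡.sym ∘ proj₁ ∘ position-unique))
               (≡.sym ([]≔-elsewhere u (i≢row ∘ ≡.sym ∘ proj₁ ∘ position-unique)))))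

  -- By pigeonhole two of the d·n rows (a r, b r) ∈ Fin n × Fin n coincide.
  det-pigeonhole : n ℕ.* n ℕ.< d ℕ.* n → ∀ (v w : Vectors) (a b : Fin (d ℕ.* n) → Fin n) →
                   Det (λ r k → v k (a r) * w k (b r)) ≈ 0#
  det-pigeonhole n²<dn v w a b with pigeonhole n²<dn (λ r → combine (a r) (b r))
  ... | r₁ , r₂ , r₁<r₂ , same = det-equal-rows (λ r₁≡r₂ → ℕ.<-irrefl (≡.cong Fin.toℕ r₁≡r₂) r₁<r₂) _
    (λ k → reflexive (≡.cong₂ (λ x y → v k x * w k y) (proj₁ same-indices) (proj₂ same-indices)))
    where same-indices = combine-injective (a r₁) (b r₁) (a r₂) (b r₂) same

  module _ {S T : Array d n} (S-filling : IsFilling d n S) (T-filling : IsFilling d n T) where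

    alternatingSum : Form
    alternatingSum v w = ∑Code (λ π → sign (inversions π) * (detProduct S (v ∘ decode π) * detProduct T (w ∘ decode π)))

    -- Expanding detProduct S and detProduct T multilinearly, each coefficient of the alternating sum
    -- is a determinant with two equal rows.
    alternatingSum-vanishes : n ℕ.* n ℕ.< d ℕ.* n → ∀ v w → alternatingSum v w ≈ 0#
    alternatingSum-vanishes n²<dn v w = begin
      alternatingSum v w
        ≈⟨ ∑Code-cong (λ π → *-congˡ (*-cong (multilinear-expansion (detProduct-multilinear S-filling) (v ∘ decode π))
                                              (multilinear-expansion (detProduct-multilinear T-filling) (w ∘ decode π)))) ⟩
      ∑Code (λ π → sign (inversions π) * (∑Map (X π) * ∑Map (Y π))) ≈⟨ ∑Code-cong (λ π → distribute _ (X π) (Y π)) ⟩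
      ∑Code (λ π → ∑Map (λ a → ∑Map (λ b → term π a b)))            ≈⟨ ∑Code-∑Map (λ π a → ∑Map (term π a)) ⟩
      ∑Map (λ a → ∑Code (λ π → ∑Map (λ b → term π a b)))            ≈⟨ ∑Map-cong (λ a → ∑Code-∑Map (λ π → term π a)) ⟩
      ∑Map (λ a → ∑Map (λ b → ∑Code (λ π → term π a b)))            ≈⟨ ∑Map-zero (λ a → ∑Map-zero (λ b → coefficient-vanishes a b)) ⟩
      0#                                                            ∎
      where
      X Y : LehmerCode (d ℕ.* n) → (Fin (d ℕ.* n) → Fin n) → Carrier
      X π a = ∏ (λ k → v (decode π k) (a k)) * detProduct S (basis ∘ a)
      Y π b = ∏ (λ k → w (decode π k) (b k)) * detProduct T (basis ∘ b)
      term : LehmerCode (d ℕ.* n) → (Fin (d ℕ.* n) → Fin n) → (Fin (d ℕ.* n) → Fin n) → Carrier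
      term π a b = sign (inversions π) * (X π a * Y π b)
      distribute : ∀ s (f g : (Fin (d ℕ.* n) → Fin n) → Carrier) → s * (∑Map f * ∑Map g) ≈ ∑Map (λ a → ∑Map (λ b → s * (f a * g b)))
      distribute s f g = begin
        s * (∑Map f * ∑Map g)                     ≈⟨ *-congˡ (*-distribʳ-∑Map _ f) ⟩
        s * ∑Map (λ a → f a * ∑Map g)             ≈⟨ *-congˡ (∑Map-cong (λ a → *-distribˡ-∑Map (f a) g)) ⟩
        s * ∑Map (λ a → ∑Map (λ b → f a * g b))   ≈⟨ *-distribˡ-∑Map s (λ a → ∑Map (λ b → f a * g b)) ⟩
        ∑Map (λ a → s * ∑Map (λ b → f a * g b))   ≈⟨ ∑Map-cong (λ a → *-distribˡ-∑Map s (λ b → f a * g b)) ⟩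
        ∑Map (λ a → ∑Map (λ b → s * (f a * g b))) ∎
      coefficient-vanishes : ∀ a b → ∑Code (λ π → term π a b) ≈ 0#
      coefficient-vanishes a b = begin
        ∑Code (λ π → term π a b)
          ≈⟨ ∑Code-cong (λ π → trans (rearrange _ _ _ _ _)
                         (*-congˡ (*-congˡ (sym (∏-distrib-* (λ k → v (decode π k) (a k)) (λ k → w (decode π k) (b k))))))) ⟩
        ∑Code (λ π → (detProduct S (basis ∘ a) * detProduct T (basis ∘ b)) * (sign (inversions π) * ∏ (λ k → M k (decode π k))))
          ≈⟨ *-distribˡ-∑Code _ (λ π → sign (inversions π) * ∏ (λ k → M k (decode π k))) ⟨
        (detProduct S (basis ∘ a) * detProduct T (basis ∘ b)) * ∑Code (λ π → sign (inversions π) * ∏ (λ k → M k (decode π k)))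
          ≈⟨ *-congˡ (trans (sym (leibniz M)) (det-pigeonhole n²<dn v w a b)) ⟩
        (detProduct S (basis ∘ a) * detProduct T (basis ∘ b)) * 0# ≈⟨ zeroʳ _ ⟩
        0#                                                         ∎
        where
        M : Matrix (d ℕ.* n)
        M r k = v k (a r) * w k (b r)
        rearrange : ∀ s A P B Q → s * ((A * P) * (B * Q)) ≈ (P * Q) * (s * (A * B))
        rearrange s A P B Q = begin
          s * ((A * P) * (B * Q)) ≈⟨ *-congˡ (trans (interchange A P B Q) (*-comm _ _)) ⟩
          s * ((P * Q) * (A * B)) ≈⟨ x∙yz≈y∙xz s _ _ ⟩
          (P * Q) * (s * (A * B)) ∎

open import Data.Nat as ℕ using (zero; suc; _≤_; s≤s; _!)
import Data.Nat.Properties as ℕ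
open import Data.Fin using (Fin; zero; suc; toℕ; inject₁)
open import Data.Fin.Properties using (any?; toℕ-inject₁)
open import Data.Fin.Subset using (∣_∣)
import Data.Fin.Permutation as Perm
open import Data.Fin.Permutation.Components using (transpose)
open import Data.List using (List; []; _∷_; map)
open import Data.List.Properties using (length-map)
open import Data.Product using (Σ-syntax; ∃-syntax; _,_; proj₂)
open import Data.Sum using (inj₁; inj₂)
open import Relation.Nullary using (Dec; yes; no)
open import Relation.Binary.Construct.Closure.ReflexiveTransitive using (Star)
open import Relation.Binary.PropositionalEquality as ≡ using (_≡_; _≢_)
open Transpositions
open LehmerCodes
open Fillings
open Connectivity
open import Defs using (IsField; CharZero; natR; Tableau; MTerm; φ; φComb)

module CharacteristicZero {c ℓ : Level} (F : CommutativeRing c ℓ) (isField : IsField F) (charZero : CharZero F) where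
  open CommutativeRing F hiding (zero)
  open BigOperators F
  open Determinant F

  natR-+ : ∀ a b → natR F (a ℕ.+ b) ≈ natR F a + natR F b
  natR-+ zero    b = sym (+-identityˡ _)
  natR-+ (suc a) b = trans (+-congˡ (natR-+ a b)) (sym (+-assoc _ _ _))

  ∑-natR : ∀ k x → ∑ {k} (λ _ → natR F x) ≈ natR F (k ℕ.* x)
  ∑-natR zero    x = ∑-empty _
  ∑-natR (suc k) x = trans (∑-suc _) (trans (+-congˡ (∑-natR k x)) (sym (natR-+ x (k ℕ.* x))))

  ∑Code-ones : ∀ m → ∑Code {m} (λ _ → 1#) ≈ natR F (m !)
  ∑Code-ones zero    = sym (+-identityʳ 1#)
  ∑Code-ones (suc m) = trans (∑-cong (λ _ → ∑Code-ones m)) (∑-natR (suc m) (m !))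

  natR-suc⁻¹ : ∀ m → ∃[ y ] y * natR F (suc m) ≈ 1#
  natR-suc⁻¹ m with proj₂ isField (natR F (suc m)) (charZero m)
  ... | y , x*y≈1 = y , trans (*-comm _ _) x*y≈1

  two⁻¹ : TwoInvertible
  two⁻¹ with natR-suc⁻¹ 1
  ... | ½ , ½*2≈1 = ½ , trans (*-comm _ _) (trans (*-congˡ (+-congˡ (sym (+-identityʳ 1#)))) ½*2≈1)

  factorial⁻¹ : ∀ m → ∃[ y ] y * ∑Code {m} (λ _ → 1#) ≈ 1#
  factorial⁻¹ m with natR-suc⁻¹ (ℕ.pred (m !))
  ... | y , y*m!≈1 = y , trans (*-congˡ (trans (∑Code-ones m) (reflexive (≡.cong (natR F) (≡.sym (ℕ.suc-pred (m !) {{m ℕ.!≢0}})))))) y*m!≈1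

module SimpleConnected {c ℓ : Level} (F : CommutativeRing c ℓ) (isField : IsField F) (charZero : CharZero F)
                       (d′ n′ : ℕ) (n<d : n′ ℕ.< d′) {S T : Array (suc d′) (suc n′)}
                       (S-filling : IsFilling (suc d′) (suc n′) S) (T-filling : IsFilling (suc d′) (suc n′) T)
                       (simple : ¬ HasMultipleEdge (TableauOf.C S-filling T-filling))
                       (paths : ∀ k l → Star (TableauGraph.Linked S-filling T-filling) k l) where
  open CommutativeRing F hiding (zero)
  open BigOperators F
  open Determinant F
  open CharacteristicZero F isField charZero
  open Span F (suc d′) (suc n′)
  open Vanishing F (suc d′) (suc n′) two⁻¹
  open Antisymmetry F (suc d′) (suc n′) two⁻¹ S-filling T-filling simple
  open Connected paths

  -- d * n reduces to suc m, so words of adjacent swaps act on the labels.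
  m : ℕ
  m = n′ ℕ.+ d′ ℕ.* suc n′

  adjacentTranspositions : Word m → List Transposition
  adjacentTranspositions = map (λ t → (inject₁ t , suc t) , inject₁≢suc t)
    where
    inject₁≢suc : ∀ {k} (t : Fin k) → inject₁ t ≢ suc t
    inject₁≢suc t e = ℕ.<-irrefl (≡.trans (≡.sym (toℕ-inject₁ t)) (≡.cong toℕ e)) (ℕ.n<1+n (toℕ t))

  word-adjacentTranspositions : ∀ ts k → word (adjacentTranspositions ts) Perm.⟨$⟩ʳ k ≡ apply ts k
  word-adjacentTranspositions []       k = ≡.refl
  word-adjacentTranspositions (t ∷ ts) k = ≡.trans (≡.cong (transpose (inject₁ t) (suc t)) (word-adjacentTranspositions ts k))
                                                   (≡.sym (adjacentSwap≡transpose t (apply ts k)))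

  permutation : LehmerCode (suc m) → Perm.Permutation′ (suc m)
  permutation π = word (adjacentTranspositions (codeWord π)) Perm.∘ₚ Perm.id

  permutation-decode : ∀ π k → permutation π Perm.⟨$⟩ʳ k ≡ decode π k
  permutation-decode π k = ≡.trans (word-adjacentTranspositions (codeWord π) k) (apply-codeWord π k)

  sign-of-code : ∀ π → φ[ permutation π ] ≃ sign (inversions π) · φ[ Perm.id ] mod𝔐
  sign-of-code π = ≃-coeff (reflexive (≡.cong sign (≡.trans (length-map _ (codeWord π)) (length-codeWord π))))
                           (φ[word]≃sign (adjacentTranspositions (codeWord π)) Perm.id)

  alternatingSum≃ : alternatingSum S-filling T-filling ≃ ∑Code {suc m} (λ _ → 1#) · φ F S T mod𝔐
  alternatingSum≃ = ≃-congˡ (λ v w → ∑Code-cong (λ π → *-congˡ (sym (trans (φ≈detProduct _ _ v w)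
                      (*-cong (∏-cong (λ i → det-cong≡ (λ r s → ≡.cong (λ k → v k r) (permutation-decode π (S i s)))))
                              (∏-cong (λ j → det-cong≡ (λ r s → ≡.cong (λ k → w k r) (permutation-decode π (T j s))))))))))
                    (≃-coeff (∑Code-cong {suc m} (λ π → sign-square (inversions π)))
                      (≃-∑Code (λ π → ≃-scale (sign (inversions π)) (sign-of-code π))))

  inφ𝔐 : Inφ𝔐 (φ F S T)
  inφ𝔐 = vanishing-≃⇒inφ𝔐 (alternatingSum-vanishes S-filling T-filling (ℕ.*-monoˡ-< (suc n′) (s≤s n<d)))
                          alternatingSum≃ (proj₂ (factorial⁻¹ (suc m)))

open import Data.Nat using (_*_)

multipleEdge? : ∀ {d n} (C : Tableau d n) → Dec (HasMultipleEdge C)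
multipleEdge? C = any? (λ i → any? (λ j → 2 ℕ.≤? ∣ C i j ∣))

mainTheorem9 : ∀ {c ℓ : Level} (F : CommutativeRing c ℓ) →
    IsField F → CharZero F →
    ∀ (n d : ℕ) → 1 ≤ n → 1 ≤ d → suc n ≤ d →
    ∀ (S T : Fin d → Fin n → Fin (d * n)) →
    IsFilling d n S → IsFilling d n T →
    Σ[ ts ∈ List (MTerm F d n) ] (∀ (v w : Fin (d * n) → Fin n → CommutativeRing.Carrier F) →
      CommutativeRing._≈_ F (φ F S T v w) (φComb F ts v w))
mainTheorem9 F isField charZero (suc n′) (suc d′) _ _ (s≤s n′<d′) S T S-filling T-filling
  with multipleEdge? (TableauOf.C S-filling T-filling)
... | yes multiple = Span.inM⇒inφ𝔐 F (suc d′) (suc n′) S-filling T-filling (inj₂ multiple)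
... | no simple with TableauGraph.linked-or-disconnected S-filling T-filling zero
...   | inj₂ disconnected = Span.inM⇒inφ𝔐 F (suc d′) (suc n′) S-filling T-filling (inj₁ disconnected)
...   | inj₁ paths        = SimpleConnected.inφ𝔐 F isField charZero d′ n′ n′<d′ S-filling T-filling simple paths
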